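{- Let $G$ be the Chevalley group of type $B_l$ over $K=GF(q)$ with $\mathrm{char}(K)=2$, with fundamental roots $r_1,\dots,r_l$ numbered so that the Dynkin diagram is $r_1 \Rightarrow r_2 - \cdots - r_l$ with $r_1$ short ($w_1(r_2)=r_2+2r_1$, $w_2(r_1)=r_1+r_2$). Let $w=w_1\cdots w_l$, $n_w\in N$ represent $w$, $\lambda$ generate $GF(q)^*$, $t=2r_1+r_2+\dots+r_l$ and $s = r_2+\dots+r_l$. Let $$\Gamma_b' = \mathrm{Cay}\big(G,\{x_s(1), x_{ -r_1}(1), n_w, n_w^{ -1}, h_t(\lambda), h_t(\lambda)^{ -1}\}\big),$$ $K_b = \langle X_{r_1}, X_{ -r_1}, \dots, X_{r_{l-1}}, X_{ -r_{l-1}}\rangle$ and $S_b=\bigcup_{i=0}^{l-2}K_b n_w^i$. Then $\frac{|\partial S_b|}{|S_b|}\le \frac{5}{l-1}$ (boundary in $\Gamma_b'$).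
   Context: $G$ is generated by root elements $x_r(t)$; $X_r=\{x_r(t)\}$. For $t\in K^*$: $n_r(t)=x_r(t)x_{ -r}(-t^{ -1})x_r(t)$, $n_r=n_r(1)$, $h_r(t)=n_r(t)n_r(-1)$; $H=\langle h_r(t)\rangle$, $N=\langle H,n_r\rangle$, $N/H\cong W$ via $n_rH\mapsto w_r$; $w_k$ is the reflection in $r_k$. Cayley graph: vertex set $G$, $g\sim h$ iff $g^{ -1}h$ lies in the connection set; $\partial S$ is the set of vertices outside $S$ with a neighbour in $S$. -}

module Defs where

open import Level using (0ℓ)
open import Data.Nat as ℕ using (ℕ; zero; suc; _<_)
open import Data.Fin as Fin using (Fin; zero; suc; toℕ; inject₁; fromℕ; _↑ˡ_; _↑ʳ_)
open import Data.Nat.Properties using (1+n≢n)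
open import Data.Fin.Properties using (toℕ-inject₁; toℕ-fromℕ)
open import Data.List using (List; []; _∷_; length; map; allFin)
open import Data.List.Relation.Unary.All using (All)
open import Data.List.Relation.Unary.Any using (Any)
open import Data.List.Relation.Unary.AllPairs using (AllPairs)
open import Data.Product using (Σ; ∃; ∃-syntax; _×_; _,_)
open import Data.Sum using (_⊎_)
open import Relation.Nullary using (¬_; Dec; yes; no)
open import Relation.Binary.PropositionalEquality using (_≡_; _≢_; refl; cong; trans; sym)
open import Algebra.Bundles using (CommutativeRing)

record FiniteField2 : Set₁ where
  field
    commRing : CommutativeRing 0ℓ 0ℓ
  open CommutativeRing commRing public
  field
    _⁻¹     : Carrier → Carrier
    0≉1     : ¬ (0# ≈ 1#)
    inverse : ∀ x → ¬ (x ≈ 0#) → (x * (x ⁻¹)) ≈ 1#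
    char2   : (1# + 1#) ≈ 0#
    elems   : List Carrier
    finite  : ∀ x → Any (x ≈_) elems

-- Signs and roots of type B_l, realised in ℝ^l with basis e_0 … e_{l-1}
--   short roots  ±e_i ,  long roots  ±e_i ± e_j  (i ≠ j)

data Sign : Set where
  plus minus : Sign

flipS : Sign → Sign
flipS plus  = minus
flipS minus = plus

data Root (l : ℕ) : Set where
  sh : Sign → Fin l → Root l
  lg : (a : Sign) (i : Fin l) (b : Sign) (j : Fin l) →
       i ≢ j → Root l

negR : ∀ {l} → Root l → Root l
negR (sh a i)         = sh (flipS a) i
negR (lg a i b j i≢j) = lg (flipS a) i (flipS b) j i≢j

private
  suc≢inject₁ : ∀ {m} (k : Fin m) → suc k ≢ inject₁ k
  suc≢inject₁ k eq = 1+n≢n ((trans (cong toℕ eq) (toℕ-inject₁ k)))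

  last≢0 : ∀ n → fromℕ (suc n) ≢ zero
  last≢0 n ()

-- Fundamental roots r_1,…,r_l (indexed 0,…,l-1 by Fin l):
--   r_1 = e_1 (short),  r_{k+1} = e_{k+1} − e_k   (k ≥ 1)
-- so that w_1(r_2) = r_2 + 2 r_1 and w_2(r_1) = r_1 + r_2.
simpleRoot : ∀ {m} → Fin (suc m) → Root (suc m)
simpleRoot zero    = sh plus zero
simpleRoot (suc k) = lg plus (suc k) minus (inject₁ k) (suc≢inject₁ k)

-- For l = n + 2:  s = r_2 + … + r_l = e_l − e_1 ,  t = 2 r_1 + s = e_l + e_1
sRoot : ∀ n → Root (suc (suc n))
sRoot n = lg plus (fromℕ (suc n)) minus zero (last≢0 n)

tRoot : ∀ n → Root (suc (suc n))
tRoot n = lg plus (fromℕ (suc n)) plus zero (last≢0 n)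

-- The Chevalley group of type B_l over K (char K = 2), in its natural
-- (2l+1)-dimensional orthogonal representation with basis
--   v_0 , v_{+i} , v_{-i}  (i : Fin l),  quadratic form x_0² + Σ x_i x_{-i}.

module Chevalley (F : FiniteField2) (l : ℕ) where
  open FiniteField2 F using (Carrier; _≈_; _+_; _*_; -_; 0#; 1#; _⁻¹)

  Idx : Set
  Idx = Fin (suc (l ℕ.+ l))

  v0 : Idx
  v0 = zero

  vec : Sign → Fin l → Idx
  vec plus  i = suc (i ↑ˡ l)
  vec minus i = suc (l ↑ʳ i)

  Mat : Set
  Mat = Idx → Idx → Carrier

  δ : Idx → Idx → Carrier
  δ a b with a Fin.≟ b
  ... | yes _ = 1#
  ... | no  _ = 0#

  E : Idx → Idx → Mat
  E a b i j = δ i a * δ j b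

  I : Mat
  I = δ

  _⊕_ : Mat → Mat → Mat
  (A ⊕ B) i j = A i j + B i j

  _⊙_ : Carrier → Mat → Mat
  (c ⊙ A) i j = c * A i j

  Σ′ : ∀ {n} → (Fin n → Carrier) → Carrier
  Σ′ {zero}  f = 0#
  Σ′ {suc n} f = f zero + Σ′ (λ k → f (suc k))

  _·_ : Mat → Mat → Mat
  (A · B) i j = Σ′ (λ k → A i k * B k j)

  _≈M_ : Mat → Mat → Set
  A ≈M B = ∀ i j → A i j ≈ B i j

  prod : List Mat → Mat
  prod []       = I
  prod (A ∷ As) = A · prod As

  _^_ : Mat → ℕ → Mat
  A ^ zero  = I
  A ^ suc k = A · (A ^ k)

  x : Root l → Carrier → Mat
  x (sh a i) u =
    (I ⊕ (u ⊙ E v0 (vec (flipS a) i))) ⊕ ((u * u) ⊙ E (vec a i) (vec (flipS a) i))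
  x (lg a i b j _) u =
    I ⊕ (u ⊙ (E (vec a i) (vec (flipS b) j) ⊕ E (vec b j) (vec (flipS a) i)))

  nR : Root l → Carrier → Mat
  nR r u = x r u · (x (negR r) (- (u ⁻¹)) · x r u)

  hR : Root l → Carrier → Mat
  hR r u = nR r u · nR r (- 1#)

  -- subgroup generated by an inverse-closed set P (as products of generators)
  Gen : (Mat → Set) → Mat → Set
  Gen P g = Σ (List Mat) λ gs → All P gs × (prod gs ≈M g)

  XGen : Mat → Set
  XGen A = Σ (Root l) λ r → Σ Carrier λ u → A ≡ x r u

  InG : Mat → Set
  InG = Gen XGen

  HGen : Mat → Set
  HGen A = Σ (Root l) λ r → Σ Carrier λ u → ¬ (u ≈ 0#) × (A ≡ hR r u)

  InH : Mat → Set
  InH = Gen HGen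

  HasSize : (Mat → Set) → ℕ → Set
  HasSize P k = Σ (List Mat) λ as →
      (length as ≡ k)
    × AllPairs (λ A B → ¬ (A ≈M B)) as
    × All P as
    × (∀ g → P g → Any (g ≈M_) as)

  -- Cayley graph Cay(G, C): g ~ h iff g⁻¹h ∈ C, i.e. h = g c with c ∈ C.
  -- Vertex boundary ∂S = { g ∈ G : g ∉ S, ∃ c ∈ C, g c ∈ S }.
  Boundary : (C : Mat → Set) (S : Mat → Set) → Mat → Set
  Boundary C S g = InG g × ¬ S g × Σ Mat λ c → C c × S (g · c)

module Setup (F : FiniteField2) (n : ℕ) where
  open FiniteField2 F using (Carrier; _≈_; _+_; _*_; -_; 0#; 1#; _⁻¹)
  l : ℕ
  l = suc (suc n)
  open Chevalley F l public

  _^′_ : Carrier → ℕ → Carrier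
  u ^′ zero  = 1#
  u ^′ suc k = u * (u ^′ k)

  nProd : Mat
  nProd = prod (map (λ i → nR (simpleRoot i) 1#) (allFin l))

  KbGen : Mat → Set
  KbGen A = Σ (Fin l) λ i → (toℕ i < suc n) × Σ Sign λ ε → Σ Carrier λ u →
            A ≡ x (signed ε (simpleRoot i)) u
    where
      signed : Sign → Root l → Root l
      signed plus  r = r
      signed minus r = negR r

  InKb : Mat → Set
  InKb = Gen KbGen

  Sb : Mat → Mat → Set
  Sb nw g = Σ ℕ λ i → (i < suc n) × Σ Mat λ k → InKb k × (g ≈M (k · (nw ^ i)))

  Conn : Mat → Carrier → Mat → Set
  Conn nw λ′ c =
      (c ≈M x (sRoot n) 1#)
    ⊎ (c ≈M x (negR (simpleRoot zero)) 1#)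
    ⊎ (c ≈M nw)
    ⊎ ((nw · c) ≈M I)
    ⊎ (c ≈M hR (tRoot n) λ′)
    ⊎ ((hR (tRoot n) λ′ · c) ≈M I)

-- Since char K = 2, every root element is an
-- involution, n_r(1) is a permutation matrix, and H consists of diagonal matrices of the split torus; so
-- n_w acts on the basis, up to a diagonal factor, by the signed cycle e_1 → e_2 → ⋯ → e_l → -e_1.
-- Conjugation by n_w therefore moves x_{-r_1}, x_{±t} and x_s along root elements which lie in K_b for
-- the relevant powers of n_w. Hence if g c = k n_w^i ∈ S_b for a generator c, then g ∈ S_b except for five
-- pairs (c, i), and ∂S_b is covered by five cosets K_b m_τ. Every element of K_b fixes the coordinate row
-- of v_{+l}, whereas that row of n_w^i determines i (0 ≤ i ≤ l-2); so k n_w^i determines both k and i,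
-- and (g, i) ↦ (τ(g), k_g n_w^i) embeds ∂S_b × {0, …, l-2} into {1, …, 5} × S_b.
module Submission where

open import Defs
open import Data.Nat as ℕ using (ℕ; zero; suc; _≤_; _<_; z≤n; s≤s)
import Data.Nat.Properties as ℕₚ
open import Data.Fin as Fin using (Fin; toℕ; inject₁)
import Data.Fin.Properties as Finₚ
open import Data.List using (List; []; _∷_; _++_; length; lookup; tabulate)
import Data.List.Properties as Listₚ
open import Data.List.Relation.Unary.All using (All; []; _∷_)
import Data.List.Relation.Unary.All.Properties as Allₚ
open import Data.List.Relation.Unary.Any using (Any)
import Data.List.Relation.Unary.Any as Any
import Data.List.Relation.Unary.Any.Properties as Anyₚ
open import Data.List.Relation.Unary.AllPairs using (AllPairs; []; _∷_)
open import Data.Maybe using (Maybe; just; nothing)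
import Data.Maybe as Maybe
open import Data.Product using (Σ; _×_; _,_; proj₁; proj₂)
open import Data.Sum using (_⊎_; inj₁; inj₂; [_,_])
open import Data.Empty using (⊥-elim)
open import Relation.Nullary using (¬_; Dec; yes; no)
open import Relation.Binary.Bundles using (Setoid)
open import Relation.Binary.Definitions using (Tri; tri<; tri≈; tri>)
open import Relation.Binary.PropositionalEquality as ≡ using (_≡_; _≢_)
import Relation.Binary.Reasoning.Setoid as SetoidReasoning
import Algebra.Properties.Semiring.Mult as SemiringMult
import Algebra.Solver.Ring.NaturalCoefficients as NaturalCoefficients
import Algebra.Properties.CommutativeSemigroup as CommSemigroupProperties
open import Function.Definitions using (Injective)
open import Function.Base using (_∘_)
open import Data.List.Membership.Propositional.Properties using (∈-lookup)
import Data.List.Relation.Unary.All as All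

module Char2 (F : FiniteField2) where
  open FiniteField2 F public hiding (zero)
  open SetoidReasoning setoid
  open SemiringMult semiring using () renaming (_×_ to _×ᵤ_)

  x+x≈0 : ∀ a → a + a ≈ 0#
  x+x≈0 a = begin
    a + a           ≈⟨ +-cong (sym (*-identityʳ a)) (sym (*-identityʳ a)) ⟩
    a * 1# + a * 1# ≈⟨ sym (distribˡ a 1# 1#) ⟩
    a * (1# + 1#)   ≈⟨ *-congˡ char2 ⟩
    a * 0#          ≈⟨ zeroʳ a ⟩
    0#              ∎

  -x≈x : ∀ a → - a ≈ a
  -x≈x a = begin
    - a           ≈⟨ sym (+-identityʳ (- a)) ⟩
    - a + 0#      ≈⟨ +-congˡ (sym (x+x≈0 a)) ⟩
    - a + (a + a) ≈⟨ sym (+-assoc (- a) a a) ⟩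
    (- a + a) + a ≈⟨ +-congʳ (-‿inverseˡ a) ⟩
    0# + a        ≈⟨ +-identityˡ a ⟩
    a             ∎

  2+k≈k : ∀ k → suc (suc k) ×ᵤ 1# ≈ k ×ᵤ 1#
  2+k≈k k = begin
    1# + (1# + k ×ᵤ 1#) ≈⟨ sym (+-assoc 1# 1# _) ⟩
    (1# + 1#) + k ×ᵤ 1# ≈⟨ +-congʳ char2 ⟩
    0# + k ×ᵤ 1#        ≈⟨ +-identityˡ _ ⟩
    k ×ᵤ 1#             ∎

  -- Numerals are compared modulo 2, so the ring solver below knows that 1 + 1 = 0.
  numeral-≈? : ∀ m k → Maybe (m ×ᵤ 1# ≈ k ×ᵤ 1#)
  numeral-≈? (suc (suc m)) k             = Maybe.map (trans (2+k≈k m)) (numeral-≈? m k)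
  numeral-≈? zero          (suc (suc k)) = Maybe.map (λ p → trans p (sym (2+k≈k k))) (numeral-≈? zero k)
  numeral-≈? (suc zero)    (suc (suc k)) = Maybe.map (λ p → trans p (sym (2+k≈k k))) (numeral-≈? (suc zero) k)
  numeral-≈? zero          zero          = just refl
  numeral-≈? (suc zero)    (suc zero)    = just refl
  numeral-≈? zero          (suc zero)    = nothing
  numeral-≈? (suc zero)    zero          = nothing

  open NaturalCoefficients commutativeSemiring numeral-≈? public using (solve; _:=_; _:+_; _:*_; con)

  1≉0 : ¬ 1# ≈ 0#
  1≉0 e = 0≉1 (sym e)

  -1≈1 : - 1# ≈ 1#
  -1≈1 = -x≈x 1#

  -1≉0 : ¬ - 1# ≈ 0#
  -1≉0 e = 1≉0 (trans (sym -1≈1) e)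

  -⁻¹-inverseˡ : ∀ u → ¬ u ≈ 0# → (- (u ⁻¹)) * u ≈ 1#
  -⁻¹-inverseˡ u u≉0 = trans (*-congʳ (-x≈x _)) (trans (*-comm _ _) (inverse u u≉0))

  ≈1⇒⁻¹≈1 : ∀ u → u ≈ 1# → u ⁻¹ ≈ 1#
  ≈1⇒⁻¹≈1 u u≈1 = trans (sym (*-identityˡ _)) (trans (*-congʳ (sym u≈1)) (inverse u (λ u≈0 → 0≉1 (trans (sym u≈0) u≈1))))

  -1⁻¹≈1 : - (1# ⁻¹) ≈ 1#
  -1⁻¹≈1 = trans (-x≈x _) (≈1⇒⁻¹≈1 _ refl)

  -[-1]⁻¹≈1 : - ((- 1#) ⁻¹) ≈ 1#
  -[-1]⁻¹≈1 = trans (-x≈x _) (≈1⇒⁻¹≈1 _ -1≈1)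

  Unit : Carrier → Set
  Unit u = Σ Carrier λ v → u * v ≈ 1#

  Unit⇒≉0 : ∀ {u} → Unit u → ¬ u ≈ 0#
  Unit⇒≉0 (v , uv≈1) u≈0 = 0≉1 (trans (sym (zeroˡ v)) (trans (*-congʳ (sym u≈0)) uv≈1))

  open CommSemigroupProperties *-commutativeSemigroup public using () renaming (interchange to *-interchange)

  Unit-* : ∀ {u v} → Unit u → Unit v → Unit (u * v)
  Unit-* {u} {v} (u′ , uu′≈1) (v′ , vv′≈1) =
    u′ * v′ , trans (*-interchange u v u′ v′) (trans (*-cong uu′≈1 vv′≈1) (*-identityˡ 1#))

module Matrices (F : FiniteField2) (l : ℕ) where
  open Char2 F public
  open Chevalley F l public
  open SetoidReasoning setoid

  -- δ on an arbitrary Fin m, so that Σ′-δ′ can recurse on m.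
  δ′ : ∀ {m} → Fin m → Fin m → Carrier
  δ′ a b with a Fin.≟ b
  ... | yes _ = 1#
  ... | no  _ = 0#

  δ≡δ′ : ∀ a b → δ a b ≡ δ′ a b
  δ≡δ′ a b with a Fin.≟ b
  ... | yes _ = ≡.refl
  ... | no  _ = ≡.refl

  δ′-refl : ∀ {m} (a : Fin m) → δ′ a a ≡ 1#
  δ′-refl a with a Fin.≟ a
  ... | yes _   = ≡.refl
  ... | no a≢a = ⊥-elim (a≢a ≡.refl)

  δ′-≢ : ∀ {m} {a b : Fin m} → a ≢ b → δ′ a b ≡ 0#
  δ′-≢ {a = a} {b} a≢b with a Fin.≟ b
  ... | yes a≡b = ⊥-elim (a≢b a≡b)
  ... | no  _   = ≡.refl

  δ′-sym : ∀ {m} (a b : Fin m) → δ′ a b ≡ δ′ b a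
  δ′-sym a b with a Fin.≟ b
  ... | yes ≡.refl = ≡.sym (δ′-refl a)
  ... | no a≢b     = ≡.sym (δ′-≢ (λ b≡a → a≢b (≡.sym b≡a)))

  δ′-suc : ∀ {m} (a b : Fin m) → δ′ (Fin.suc a) (Fin.suc b) ≡ δ′ a b
  δ′-suc a b = by-cases (a Fin.≟ b)
    where
    by-cases : Dec (a ≡ b) → δ′ (Fin.suc a) (Fin.suc b) ≡ δ′ a b
    by-cases (yes ≡.refl) = ≡.trans (δ′-refl (Fin.suc a)) (≡.sym (δ′-refl a))
    by-cases (no a≢b)     = ≡.trans (δ′-≢ (λ e → a≢b (Finₚ.suc-injective e))) (≡.sym (δ′-≢ a≢b))

  δ-refl : ∀ a → δ a a ≈ 1#
  δ-refl a = reflexive (≡.trans (δ≡δ′ a a) (δ′-refl a))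

  δ-≢ : ∀ {a b} → a ≢ b → δ a b ≈ 0#
  δ-≢ {a} {b} a≢b = reflexive (≡.trans (δ≡δ′ a b) (δ′-≢ a≢b))

  δ-sym : ∀ a b → δ a b ≡ δ b a
  δ-sym a b = ≡.trans (δ≡δ′ a b) (≡.trans (δ′-sym a b) (≡.sym (δ≡δ′ b a)))

  δ-subst : ∀ a j (f : Idx → Carrier) → δ a j * f j ≈ δ a j * f a
  δ-subst a j f = by-cases (a Fin.≟ j)
    where
    by-cases : Dec (a ≡ j) → δ a j * f j ≈ δ a j * f a
    by-cases (yes ≡.refl) = refl
    by-cases (no a≢j)     = trans (*-congʳ (δ-≢ a≢j)) (trans (zeroˡ (f j)) (sym (trans (*-congʳ (δ-≢ a≢j)) (zeroˡ (f a)))))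

  Σ′-cong : ∀ {m} (f g : Fin m → Carrier) → (∀ k → f k ≈ g k) → Σ′ f ≈ Σ′ g
  Σ′-cong {zero}  f g f≈g = refl
  Σ′-cong {suc m} f g f≈g = +-cong (f≈g Fin.zero) (Σ′-cong (λ k → f (Fin.suc k)) (λ k → g (Fin.suc k)) (λ k → f≈g (Fin.suc k)))

  Σ′-zero : ∀ {m} (f : Fin m → Carrier) → (∀ k → f k ≈ 0#) → Σ′ f ≈ 0#
  Σ′-zero {zero}  f f≈0 = refl
  Σ′-zero {suc m} f f≈0 = trans (+-cong (f≈0 Fin.zero) (Σ′-zero (λ k → f (Fin.suc k)) (λ k → f≈0 (Fin.suc k)))) (+-identityˡ 0#)

  Σ′-+ : ∀ {m} (f g : Fin m → Carrier) → Σ′ (λ k → f k + g k) ≈ Σ′ f + Σ′ g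
  Σ′-+ {zero}  f g = sym (+-identityˡ 0#)
  Σ′-+ {suc m} f g = trans (+-congˡ (Σ′-+ (λ k → f (Fin.suc k)) (λ k → g (Fin.suc k))))
    (solve 4 (λ a b c d → (a :+ b) :+ (c :+ d) := (a :+ c) :+ (b :+ d)) refl
           (f Fin.zero) (g Fin.zero) (Σ′ (λ k → f (Fin.suc k))) (Σ′ (λ k → g (Fin.suc k))))

  Σ′-*ˡ : ∀ {m} (c : Carrier) (f : Fin m → Carrier) → Σ′ (λ k → c * f k) ≈ c * Σ′ f
  Σ′-*ˡ {zero}  c f = sym (zeroʳ c)
  Σ′-*ˡ {suc m} c f = trans (+-congˡ (Σ′-*ˡ c (λ k → f (Fin.suc k)))) (sym (distribˡ c (f Fin.zero) (Σ′ (λ k → f (Fin.suc k)))))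

  Σ′-*ʳ : ∀ {m} (c : Carrier) (f : Fin m → Carrier) → Σ′ (λ k → f k * c) ≈ Σ′ f * c
  Σ′-*ʳ c f = trans (Σ′-cong (λ k → f k * c) (λ k → c * f k) (λ k → *-comm (f k) c)) (trans (Σ′-*ˡ c f) (*-comm c (Σ′ f)))

  Σ′-swap : ∀ {m p} (f : Fin m → Fin p → Carrier) →
            Σ′ (λ i → Σ′ (λ j → f i j)) ≈ Σ′ (λ j → Σ′ (λ i → f i j))
  Σ′-swap {zero}  {p} f = sym (Σ′-zero {p} (λ _ → 0#) (λ j → refl))
  Σ′-swap {suc m} {p} f = begin
    Σ′ (λ j → f Fin.zero j) + Σ′ (λ i → Σ′ (λ j → f (Fin.suc i) j))
      ≈⟨ +-congˡ (Σ′-swap (λ i j → f (Fin.suc i) j)) ⟩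
    Σ′ (λ j → f Fin.zero j) + Σ′ (λ j → Σ′ (λ i → f (Fin.suc i) j))
      ≈⟨ sym (Σ′-+ (λ j → f Fin.zero j) (λ j → Σ′ (λ i → f (Fin.suc i) j))) ⟩
    Σ′ (λ j → f Fin.zero j + Σ′ (λ i → f (Fin.suc i) j)) ∎

  Σ′-δ′ : ∀ {m} (a : Fin m) (f : Fin m → Carrier) → Σ′ (λ k → δ′ a k * f k) ≈ f a
  Σ′-δ′ {suc m} Fin.zero f = begin
    δ′ {suc m} Fin.zero Fin.zero * f Fin.zero + Σ′ (λ k → δ′ Fin.zero (Fin.suc k) * f (Fin.suc k))
      ≈⟨ +-cong (*-congʳ (reflexive (δ′-refl {suc m} Fin.zero)))
                (Σ′-zero (λ k → δ′ Fin.zero (Fin.suc k) * f (Fin.suc k))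
                         (λ k → trans (*-congʳ (reflexive (δ′-≢ {suc m} {Fin.zero} {Fin.suc k} (λ ())))) (zeroˡ (f (Fin.suc k))))) ⟩
    1# * f Fin.zero + 0# ≈⟨ trans (+-identityʳ (1# * f Fin.zero)) (*-identityˡ (f Fin.zero)) ⟩
    f Fin.zero ∎
  Σ′-δ′ {suc m} (Fin.suc a) f = begin
    δ′ (Fin.suc a) Fin.zero * f Fin.zero + Σ′ (λ k → δ′ (Fin.suc a) (Fin.suc k) * f (Fin.suc k))
      ≈⟨ +-cong (trans (*-congʳ (reflexive (δ′-≢ {suc m} {Fin.suc a} {Fin.zero} (λ ())))) (zeroˡ (f Fin.zero)))
                (Σ′-cong (λ k → δ′ (Fin.suc a) (Fin.suc k) * f (Fin.suc k)) (λ k → δ′ a k * f (Fin.suc k))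
                         (λ k → *-congʳ (reflexive (δ′-suc a k)))) ⟩
    0# + Σ′ (λ k → δ′ a k * f (Fin.suc k)) ≈⟨ +-identityˡ _ ⟩
    Σ′ (λ k → δ′ a k * f (Fin.suc k))       ≈⟨ Σ′-δ′ a (λ k → f (Fin.suc k)) ⟩
    f (Fin.suc a) ∎

  Σ′-δˡ : ∀ (a : Idx) (f : Idx → Carrier) → Σ′ (λ k → δ a k * f k) ≈ f a
  Σ′-δˡ a f = trans (Σ′-cong (λ k → δ a k * f k) (λ k → δ′ a k * f k) (λ k → *-congʳ (reflexive (δ≡δ′ a k)))) (Σ′-δ′ a f)

  Σ′-δʳ : ∀ (a : Idx) (f : Idx → Carrier) → Σ′ (λ k → f k * δ k a) ≈ f a
  Σ′-δʳ a f = trans (Σ′-cong (λ k → f k * δ k a) (λ k → δ a k * f k) (λ k → trans (*-comm _ _) (*-congʳ (reflexive (δ-sym k a))))) (Σ′-δˡ a f)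

  -- _≈M_ is a Π-type, from which Agda cannot infer the matrices; the record makes them inferable.
  infix 4 _≋_
  record _≋_ (A B : Mat) : Set where
    constructor mk
    field get : A ≈M B
  open _≋_ public

  ≋-setoid : Setoid _ _
  ≋-setoid = record
    { Carrier       = Mat
    ; _≈_           = _≋_
    ; isEquivalence = record
      { refl  = mk λ i j → refl
      ; sym   = λ (mk e) → mk λ i j → sym (e i j)
      ; trans = λ (mk e) (mk f) → mk λ i j → trans (e i j) (f i j)
      }
    }

  module ≋-Reasoning = SetoidReasoning ≋-setoid
  open Setoid ≋-setoid public using () renaming (refl to ≋-refl; sym to ≋-sym; trans to ≋-trans; reflexive to ≋-reflexive)

  ·-cong : ∀ {A A′ B B′} → A ≋ A′ → B ≋ B′ → A · B ≋ A′ · B′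
  ·-cong {A} {A′} {B} {B′} (mk e) (mk f) =
    mk λ i j → Σ′-cong (λ k → A i k * B k j) (λ k → A′ i k * B′ k j) (λ k → *-cong (e i k) (f k j))

  ·-congˡ : ∀ {A B B′} → B ≋ B′ → A · B ≋ A · B′
  ·-congˡ {A} = ·-cong {A} {A} ≋-refl

  ·-congʳ : ∀ {A A′ B} → A ≋ A′ → A · B ≋ A′ · B
  ·-congʳ {B = B} A≋A′ = ·-cong {B = B} {B′ = B} A≋A′ ≋-refl

  ·-assoc : ∀ A B C → (A · B) · C ≋ A · (B · C)
  ·-assoc A B C = mk λ i j → begin
    Σ′ (λ k → Σ′ (λ m → A i m * B m k) * C k j)
      ≈⟨ Σ′-cong _ (λ k → Σ′ (λ m → A i m * B m k * C k j)) (λ k → sym (Σ′-*ʳ (C k j) (λ m → A i m * B m k))) ⟩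
    Σ′ (λ k → Σ′ (λ m → A i m * B m k * C k j))
      ≈⟨ Σ′-swap (λ k m → A i m * B m k * C k j) ⟩
    Σ′ (λ m → Σ′ (λ k → A i m * B m k * C k j))
      ≈⟨ Σ′-cong _ (λ m → A i m * Σ′ (λ k → B m k * C k j))
                 (λ m → trans (Σ′-cong _ (λ k → A i m * (B m k * C k j)) (λ k → *-assoc _ _ _)) (Σ′-*ˡ (A i m) (λ k → B m k * C k j))) ⟩
    Σ′ (λ m → A i m * Σ′ (λ k → B m k * C k j)) ∎

  ·-identityˡ : ∀ A → I · A ≋ A
  ·-identityˡ A = mk λ i j → Σ′-δˡ i (λ k → A k j)

  ·-identityʳ : ∀ A → A · I ≋ A
  ·-identityʳ A = mk λ i j → Σ′-δʳ j (λ k → A i k)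

  ⊕-cong : ∀ {A A′ B B′} → A ≋ A′ → B ≋ B′ → A ⊕ B ≋ A′ ⊕ B′
  ⊕-cong (mk e) (mk f) = mk λ i j → +-cong (e i j) (f i j)

  ⊙-cong : ∀ {c c′ A A′} → c ≈ c′ → A ≋ A′ → c ⊙ A ≋ c′ ⊙ A′
  ⊙-cong c≈c′ (mk e) = mk λ i j → *-cong c≈c′ (e i j)

  ·-distribʳ-⊕ : ∀ A B C → (A ⊕ B) · C ≋ (A · C) ⊕ (B · C)
  ·-distribʳ-⊕ A B C = mk λ i j →
    trans (Σ′-cong _ (λ k → A i k * C k j + B i k * C k j) (λ k → distribʳ (C k j) (A i k) (B i k)))
          (Σ′-+ (λ k → A i k * C k j) (λ k → B i k * C k j))

  ·-distribˡ-⊕ : ∀ A B C → C · (A ⊕ B) ≋ (C · A) ⊕ (C · B)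
  ·-distribˡ-⊕ A B C = mk λ i j →
    trans (Σ′-cong _ (λ k → C i k * A k j + C i k * B k j) (λ k → distribˡ (C i k) (A k j) (B k j)))
          (Σ′-+ (λ k → C i k * A k j) (λ k → C i k * B k j))

  ⊙-·ˡ : ∀ c A C → (c ⊙ A) · C ≋ c ⊙ (A · C)
  ⊙-·ˡ c A C = mk λ i j →
    trans (Σ′-cong _ (λ k → c * (A i k * C k j)) (λ k → *-assoc c (A i k) (C k j))) (Σ′-*ˡ c (λ k → A i k * C k j))

  ⊙-·ʳ : ∀ c A C → C · (c ⊙ A) ≋ c ⊙ (C · A)
  ⊙-·ʳ c A C = mk λ i j →
    trans (Σ′-cong _ (λ k → c * (C i k * A k j))
                   (λ k → solve 3 (λ x y z → x :* (y :* z) := y :* (x :* z)) refl (C i k) c (A k j)))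
          (Σ′-*ˡ c (λ k → C i k * A k j))

  E·-entry : ∀ a b C i j → (E a b · C) i j ≈ δ i a * C b j
  E·-entry a b C i j = begin
    Σ′ (λ k → δ i a * δ k b * C k j)   ≈⟨ Σ′-cong _ (λ k → δ i a * (C k j * δ k b)) (λ k → trans (*-assoc _ _ _) (*-congˡ (*-comm _ _))) ⟩
    Σ′ (λ k → δ i a * (C k j * δ k b)) ≈⟨ Σ′-*ˡ (δ i a) (λ k → C k j * δ k b) ⟩
    δ i a * Σ′ (λ k → C k j * δ k b)   ≈⟨ *-congˡ (Σ′-δʳ b (λ k → C k j)) ⟩
    δ i a * C b j                      ∎

  ·E-entry : ∀ a b C i j → (C · E a b) i j ≈ C i a * δ j b
  ·E-entry a b C i j = begin
    Σ′ (λ k → C i k * (δ k a * δ j b)) ≈⟨ Σ′-cong _ (λ k → C i k * δ k a * δ j b) (λ k → sym (*-assoc _ _ _)) ⟩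
    Σ′ (λ k → C i k * δ k a * δ j b)   ≈⟨ Σ′-*ʳ (δ j b) (λ k → C i k * δ k a) ⟩
    Σ′ (λ k → C i k * δ k a) * δ j b   ≈⟨ *-congʳ (Σ′-δʳ a (λ k → C i k)) ⟩
    C i a * δ j b                      ∎

  ^-cong : ∀ {A B} m → A ≋ B → A ^ m ≋ B ^ m
  ^-cong zero    A≋B = ≋-refl
  ^-cong (suc m) A≋B = ·-cong A≋B (^-cong m A≋B)

  ^-sucʳ : ∀ A i → A ^ suc i ≋ (A ^ i) · A
  ^-sucʳ A zero    = ≋-trans (·-identityʳ A) (≋-sym (·-identityˡ A))
  ^-sucʳ A (suc i) = ≋-trans (·-congˡ {A} (^-sucʳ A i)) (≋-sym (·-assoc A (A ^ i) A))

  prod-++ : ∀ xs ys → prod (xs ++ ys) ≋ prod xs · prod ys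
  prod-++ []       ys = ≋-sym (·-identityˡ (prod ys))
  prod-++ (A ∷ xs) ys = ≋-trans (·-congˡ {A} (prod-++ xs ys)) (≋-sym (·-assoc A (prod xs) (prod ys)))

  Gen-· : ∀ {Q A B} → Gen Q A → Gen Q B → Gen Q (A · B)
  Gen-· {A = A} {B} (xs , Qxs , ∏xs≈A) (ys , Qys , ∏ys≈B) =
    xs ++ ys , Allₚ.++⁺ Qxs Qys , get (≋-trans (prod-++ xs ys) (·-cong (mk {prod xs} {A} ∏xs≈A) (mk {prod ys} {B} ∏ys≈B)))

  Gen-cong : ∀ {Q A B} → A ≋ B → Gen Q A → Gen Q B
  Gen-cong {A = A} A≋B (xs , Qxs , ∏xs≈A) = xs , Qxs , get (≋-trans (mk {prod xs} {A} ∏xs≈A) A≋B)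

  Gen-gen : ∀ {Q : Mat → Set} {A} → Q A → Gen Q A
  Gen-gen {A = A} QA = A ∷ [] , QA ∷ [] , get (·-identityʳ A)

module Indices (F : FiniteField2) (l : ℕ) where
  open Matrices F l public

  data View : Idx → Set where
    is-v0  : View v0
    is-vec : ∀ a i → View (vec a i)

  view : (x : Idx) → View x
  view Fin.zero    = is-v0
  view (Fin.suc k) = from-split k (Fin.splitAt l k) ≡.refl
    where
    from-split : ∀ k s → Fin.splitAt l k ≡ s → View (Fin.suc k)
    from-split k (inj₁ i) e = ≡.subst (λ z → View (Fin.suc z)) (Finₚ.splitAt⁻¹-↑ˡ e) (is-vec plus i)
    from-split k (inj₂ i) e = ≡.subst (λ z → View (Fin.suc z)) (Finₚ.splitAt⁻¹-↑ʳ e) (is-vec minus i)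

  vec≢v0 : ∀ a i → vec a i ≢ v0
  vec≢v0 plus  i ()
  vec≢v0 minus i ()

  flipS-involutive : ∀ a → flipS (flipS a) ≡ a
  flipS-involutive plus  = ≡.refl
  flipS-involutive minus = ≡.refl

  flipS≢ : ∀ a → flipS a ≢ a
  flipS≢ plus  ()
  flipS≢ minus ()

  vec-injective : ∀ {a b i j} → vec a i ≡ vec b j → a ≡ b × i ≡ j
  vec-injective {plus}  {plus}  {i} {j} e = ≡.refl , Finₚ.↑ˡ-injective l i j (Finₚ.suc-injective e)
  vec-injective {minus} {minus} {i} {j} e = ≡.refl , Finₚ.↑ʳ-injective l i j (Finₚ.suc-injective e)
  vec-injective {plus}  {minus} {i} {j} e = ⊥-elim (ℕₚ.<⇒≢ i<l+j (≡.trans (≡.sym (Finₚ.toℕ-↑ˡ i l))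
                                                    (≡.trans (≡.cong toℕ (Finₚ.suc-injective e)) (Finₚ.toℕ-↑ʳ l j))))
    where
    i<l+j : toℕ i < l ℕ.+ toℕ j
    i<l+j = ℕₚ.<-≤-trans (Finₚ.toℕ<n i) (ℕₚ.m≤m+n l (toℕ j))
  vec-injective {minus} {plus}  {i} {j} e with () ← proj₁ (vec-injective {plus} {minus} {j} {i} (≡.sym e))

  vec-injectiveˢ : ∀ {a b i j} → vec a i ≡ vec b j → a ≡ b
  vec-injectiveˢ e = proj₁ (vec-injective e)

  vec-injectiveⁱ : ∀ {a b i j} → vec a i ≡ vec b j → i ≡ j
  vec-injectiveⁱ e = proj₂ (vec-injective e)

  vec-flip≢ : ∀ a i → vec (flipS a) i ≢ vec a i
  vec-flip≢ a i e = flipS≢ a (vec-injectiveˢ e)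

  vec≢flip : ∀ a i → vec a i ≢ vec (flipS a) i
  vec≢flip a i = ≡.≢-sym (vec-flip≢ a i)

  vec≢ⁱ : ∀ {a b i j} → i ≢ j → vec a i ≢ vec b j
  vec≢ⁱ i≢j e = i≢j (vec-injectiveⁱ e)

  flipV : Idx → Idx
  flipV Fin.zero    = Fin.zero
  flipV (Fin.suc k) = [ vec minus , vec plus ] (Fin.splitAt l k)

  flipV-vec : ∀ a i → flipV (vec a i) ≡ vec (flipS a) i
  flipV-vec plus  i rewrite Finₚ.splitAt-↑ˡ l i l = ≡.refl
  flipV-vec minus i rewrite Finₚ.splitAt-↑ʳ l l i = ≡.refl

  flipV-involutive : ∀ x → flipV (flipV x) ≡ x
  flipV-involutive x with view x
  ... | is-v0      = ≡.refl
  ... | is-vec a i rewrite flipV-vec a i | flipV-vec (flipS a) i | flipS-involutive a = ≡.refl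

  flipV-flip : ∀ a i → flipV (vec (flipS a) i) ≡ vec a i
  flipV-flip a i = ≡.trans (flipV-vec (flipS a) i) (≡.cong (λ s → vec s i) (flipS-involutive a))

  flipV-transpose : ∀ {x p q} → flipV p ≡ q → flipV x ≡ p → x ≡ q
  flipV-transpose {x} fp fx = ≡.trans (≡.sym (flipV-involutive x)) (≡.trans (≡.cong flipV fx) fp)

  -- The four basis vectors moved by x_r for the long root r = a e_i + b e_j.
  module LongRootVectors (a : Sign) (i : Fin l) (b : Sign) (j : Fin l) (i≢j : i ≢ j) where
    p q′ q p′ : Idx
    p  = vec a i
    q′ = vec (flipS b) j
    q  = vec b j
    p′ = vec (flipS a) i

    p≢q′ : p ≢ q′
    p≢q′ = vec≢ⁱ i≢j
    p≢q : p ≢ q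
    p≢q = vec≢ⁱ i≢j
    p≢p′ : p ≢ p′
    p≢p′ = vec≢flip a i
    q′≢q : q′ ≢ q
    q′≢q = vec-flip≢ b j
    q′≢p′ : q′ ≢ p′
    q′≢p′ = vec≢ⁱ (≡.≢-sym i≢j)
    q≢p′ : q ≢ p′
    q≢p′ = vec≢ⁱ (≡.≢-sym i≢j)

-- XS p q u and XL p q′ q p′ u are the two shapes of x_r(u) in Defs, with the moved basis vectors as
-- parameters: x (sh a i) u is XS (vec a i) (vec (flipS a) i) u, and x (lg a i b j _) u is
-- XL (vec a i) (vec (flipS b) j) (vec b j) (vec (flipS a) i) u, both definitionally.
module RootElements (F : FiniteField2) (l : ℕ) where
  open Indices F l public
  open SetoidReasoning setoid

  XS : Idx → Idx → Carrier → Mat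
  XS p q u = (I ⊕ (u ⊙ E v0 q)) ⊕ ((u * u) ⊙ E p q)

  XL : Idx → Idx → Idx → Idx → Carrier → Mat
  XL p q′ q p′ u = I ⊕ (u ⊙ (E p q′ ⊕ E q p′))

  XS-cong : ∀ p q {u u′} → u ≈ u′ → XS p q u ≋ XS p q u′
  XS-cong p q u≈u′ = ⊕-cong (⊕-cong ≋-refl (⊙-cong u≈u′ ≋-refl)) (⊙-cong (*-cong u≈u′ u≈u′) ≋-refl)

  XL-cong : ∀ p q′ q p′ {u u′} → u ≈ u′ → XL p q′ q p′ u ≋ XL p q′ q p′ u′
  XL-cong p q′ q p′ u≈u′ = ⊕-cong ≋-refl (⊙-cong u≈u′ ≋-refl)

  XL-swap : ∀ p q′ q p′ u → XL p q′ q p′ u ≋ XL q p′ p q′ u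
  XL-swap p q′ q p′ u = mk λ i j → +-congˡ (*-congˡ (+-comm _ _))

  XS·-entry : ∀ p q u B i j → (XS p q u · B) i j ≈ B i j + u * (δ i v0 * B q j) + (u * u) * (δ i p * B q j)
  XS·-entry p q u B i j = begin
    (XS p q u · B) i j
      ≈⟨ get (·-distribʳ-⊕ (I ⊕ (u ⊙ E v0 q)) ((u * u) ⊙ E p q) B) i j ⟩
    ((I ⊕ (u ⊙ E v0 q)) · B) i j + (((u * u) ⊙ E p q) · B) i j
      ≈⟨ +-cong (get (·-distribʳ-⊕ I (u ⊙ E v0 q) B) i j) (get (⊙-·ˡ (u * u) (E p q) B) i j) ⟩
    ((I · B) i j + ((u ⊙ E v0 q) · B) i j) + (u * u) * (E p q · B) i j
      ≈⟨ +-cong (+-cong (get (·-identityˡ B) i j) (trans (get (⊙-·ˡ u (E v0 q) B) i j) (*-congˡ (E·-entry v0 q B i j))))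
                (*-congˡ (E·-entry p q B i j)) ⟩
    B i j + u * (δ i v0 * B q j) + (u * u) * (δ i p * B q j) ∎

  XL·-entry : ∀ p q′ q p′ u B i j → (XL p q′ q p′ u · B) i j ≈ B i j + u * (δ i p * B q′ j + δ i q * B p′ j)
  XL·-entry p q′ q p′ u B i j = begin
    (XL p q′ q p′ u · B) i j
      ≈⟨ get (·-distribʳ-⊕ I (u ⊙ (E p q′ ⊕ E q p′)) B) i j ⟩
    (I · B) i j + ((u ⊙ (E p q′ ⊕ E q p′)) · B) i j
      ≈⟨ +-cong (get (·-identityˡ B) i j)
                (trans (get (⊙-·ˡ u (E p q′ ⊕ E q p′) B) i j)
                       (*-congˡ (trans (get (·-distribʳ-⊕ (E p q′) (E q p′) B) i j) (+-cong (E·-entry p q′ B i j) (E·-entry q p′ B i j))))) ⟩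
    B i j + u * (δ i p * B q′ j + δ i q * B p′ j) ∎

  ·XS-entry : ∀ p q u C i j → (C · XS p q u) i j ≈ C i j + u * (C i v0 * δ j q) + (u * u) * (C i p * δ j q)
  ·XS-entry p q u C i j = begin
    (C · XS p q u) i j
      ≈⟨ get (·-distribˡ-⊕ (I ⊕ (u ⊙ E v0 q)) ((u * u) ⊙ E p q) C) i j ⟩
    (C · (I ⊕ (u ⊙ E v0 q))) i j + (C · ((u * u) ⊙ E p q)) i j
      ≈⟨ +-cong (get (·-distribˡ-⊕ I (u ⊙ E v0 q) C) i j) (get (⊙-·ʳ (u * u) (E p q) C) i j) ⟩
    ((C · I) i j + (C · (u ⊙ E v0 q)) i j) + (u * u) * (C · E p q) i j
      ≈⟨ +-cong (+-cong (get (·-identityʳ C) i j) (trans (get (⊙-·ʳ u (E v0 q) C) i j) (*-congˡ (·E-entry v0 q C i j))))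
                (*-congˡ (·E-entry p q C i j)) ⟩
    C i j + u * (C i v0 * δ j q) + (u * u) * (C i p * δ j q) ∎

  ·XL-entry : ∀ p q′ q p′ u C i j → (C · XL p q′ q p′ u) i j ≈ C i j + u * (C i p * δ j q′ + C i q * δ j p′)
  ·XL-entry p q′ q p′ u C i j = begin
    (C · XL p q′ q p′ u) i j
      ≈⟨ get (·-distribˡ-⊕ I (u ⊙ (E p q′ ⊕ E q p′)) C) i j ⟩
    (C · I) i j + (C · (u ⊙ (E p q′ ⊕ E q p′))) i j
      ≈⟨ +-cong (get (·-identityʳ C) i j)
                (trans (get (⊙-·ʳ u (E p q′ ⊕ E q p′) C) i j)
                       (*-congˡ (trans (get (·-distribˡ-⊕ (E p q′) (E q p′) C) i j) (+-cong (·E-entry p q′ C i j) (·E-entry q p′ C i j))))) ⟩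
    C i j + u * (C i p * δ j q′ + C i q * δ j p′) ∎

  XS·-entry′ : ∀ p q u B i j {b b′} → B i j ≈ b → B q j ≈ b′ →
               (XS p q u · B) i j ≈ b + u * (δ i v0 * b′) + (u * u) * (δ i p * b′)
  XS·-entry′ p q u B i j Bij≈b Bqj≈b′ =
    trans (XS·-entry p q u B i j) (+-cong (+-cong Bij≈b (*-congˡ (*-congˡ Bqj≈b′))) (*-congˡ (*-congˡ Bqj≈b′)))

  XL·-entry′ : ∀ p q′ q p′ u B i j {b b′ b″} → B i j ≈ b → B q′ j ≈ b′ → B p′ j ≈ b″ →
               (XL p q′ q p′ u · B) i j ≈ b + u * (δ i p * b′ + δ i q * b″)
  XL·-entry′ p q′ q p′ u B i j Bij≈b Bq′j≈b′ Bp′j≈b″ =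
    trans (XL·-entry p q′ q p′ u B i j) (+-cong Bij≈b (*-congˡ (+-cong (*-congˡ Bq′j≈b′) (*-congˡ Bp′j≈b″))))

  XS-row-q : ∀ p q u j → p ≢ q → q ≢ v0 → XS p q u q j ≈ δ j q
  XS-row-q p q u j p≢q q≢v0 = begin
    (δ q j + u * (δ q v0 * δ j q)) + (u * u) * (δ q p * δ j q)
      ≈⟨ +-cong (+-cong (reflexive (δ-sym q j)) (*-congˡ (*-congʳ (δ-≢ q≢v0)))) (*-congˡ (*-congʳ (δ-≢ (≡.≢-sym p≢q)))) ⟩
    (δ j q + u * (0# * δ j q)) + (u * u) * (0# * δ j q)
      ≈⟨ solve 3 (λ a b c → (a :+ b :* (con 0 :* c)) :+ (b :* b) :* (con 0 :* c) := a) refl (δ j q) u (δ j q) ⟩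
    δ j q ∎

  XL-row-fixed : ∀ p q′ q p′ u k j → k ≢ p → k ≢ q → XL p q′ q p′ u k j ≈ δ k j
  XL-row-fixed p q′ q p′ u k j k≢p k≢q = begin
    δ k j + u * (δ k p * δ j q′ + δ k q * δ j p′)
      ≈⟨ +-congˡ (*-congˡ (+-cong (*-congʳ (δ-≢ k≢p)) (*-congʳ (δ-≢ k≢q)))) ⟩
    δ k j + u * (0# * δ j q′ + 0# * δ j p′)
      ≈⟨ solve 4 (λ a w b c → a :+ w :* (con 0 :* b :+ con 0 :* c) := a) refl (δ k j) u (δ j q′) (δ j p′) ⟩
    δ k j ∎

  XS-involutive : ∀ p q u → p ≢ q → q ≢ v0 → XS p q u · XS p q u ≋ I
  XS-involutive p q u p≢q q≢v0 = mk λ i j → begin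
    (XS p q u · XS p q u) i j
      ≈⟨ XS·-entry′ p q u (XS p q u) i j refl (XS-row-q p q u j p≢q q≢v0) ⟩
    ((δ i j + u * (δ i v0 * δ j q)) + (u * u) * (δ i p * δ j q)) + u * (δ i v0 * δ j q) + (u * u) * (δ i p * δ j q)
      ≈⟨ solve 5 (λ a b c d w → ((a :+ w :* (b :* d)) :+ (w :* w) :* (c :* d)) :+ w :* (b :* d) :+ (w :* w) :* (c :* d) := a)
               refl (δ i j) (δ i v0) (δ i p) (δ j q) u ⟩
    δ i j ∎

  XL-involutive : ∀ p q′ q p′ u → p ≢ q → q′ ≢ p → q′ ≢ q → p′ ≢ p → p′ ≢ q → XL p q′ q p′ u · XL p q′ q p′ u ≋ I
  XL-involutive p q′ q p′ u p≢q q′≢p q′≢q p′≢p p′≢q = mk λ i j → begin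
    (X · X) i j
      ≈⟨ XL·-entry′ p q′ q p′ u X i j refl
           (trans (XL-row-fixed p q′ q p′ u q′ j q′≢p q′≢q) (reflexive (δ-sym q′ j)))
           (trans (XL-row-fixed p q′ q p′ u p′ j p′≢p p′≢q) (reflexive (δ-sym p′ j))) ⟩
    (δ i j + u * (δ i p * δ j q′ + δ i q * δ j p′)) + u * (δ i p * δ j q′ + δ i q * δ j p′)
      ≈⟨ solve 6 (λ a w b c d e → (a :+ w :* (b :* c :+ d :* e)) :+ w :* (b :* c :+ d :* e) := a)
               refl (δ i j) u (δ i p) (δ j q′) (δ i q) (δ j p′) ⟩
    δ i j ∎
    where
    X : Mat
    X = XL p q′ q p′ u

module Inverses (F : FiniteField2) (l : ℕ) where
  open RootElements F l public
  open ≋-Reasoning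

  x-involutive : ∀ r u → x r u · x r u ≋ I
  x-involutive (sh a i) u = XS-involutive (vec a i) (vec (flipS a) i) u (≡.≢-sym (vec-flip≢ a i)) (vec≢v0 (flipS a) i)
  x-involutive (lg a i b j i≢j) u =
    XL-involutive _ _ _ _ u p≢q (≡.≢-sym p≢q′) q′≢q (≡.≢-sym p≢p′) (≡.≢-sym q≢p′)
    where open LongRootVectors a i b j i≢j

  conjugate-involutive : ∀ A B → A · A ≋ I → B · B ≋ I → (A · (B · A)) · (A · (B · A)) ≋ I
  conjugate-involutive A B AA≋I BB≋I = begin
    (A · (B · A)) · (A · (B · A)) ≈⟨ ·-assoc A (B · A) (A · (B · A)) ⟩
    A · ((B · A) · (A · (B · A))) ≈⟨ ·-congˡ {A} (·-assoc B A (A · (B · A))) ⟩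
    A · (B · (A · (A · (B · A)))) ≈⟨ ·-congˡ {A} (·-congˡ {B} (≋-sym (·-assoc A A (B · A)))) ⟩
    A · (B · ((A · A) · (B · A))) ≈⟨ ·-congˡ {A} (·-congˡ {B} (≋-trans (·-congʳ {B = B · A} AA≋I) (·-identityˡ (B · A)))) ⟩
    A · (B · (B · A))             ≈⟨ ·-congˡ {A} (≋-sym (·-assoc B B A)) ⟩
    A · ((B · B) · A)             ≈⟨ ·-congˡ {A} (≋-trans (·-congʳ {B = A} BB≋I) (·-identityˡ A)) ⟩
    A · A                         ≈⟨ AA≋I ⟩
    I                             ∎

  nR-involutive : ∀ r u → nR r u · nR r u ≋ I
  nR-involutive r u = conjugate-involutive (x r u) (x (negR r) (- (u ⁻¹))) (x-involutive r u) (x-involutive (negR r) (- (u ⁻¹)))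

  right-inverse-cong : ∀ {c} C C⁻¹ → c ≈M C → C · C⁻¹ ≋ I → c · C⁻¹ ≋ I
  right-inverse-cong {c} C C⁻¹ c≈C CC⁻¹≋I = ≋-trans (·-congʳ {B = C⁻¹} (mk {c} {C} c≈C)) CC⁻¹≋I

  cancelʳ : ∀ g c c⁻¹ m → g · c ≋ m → c · c⁻¹ ≋ I → g ≋ m · c⁻¹
  cancelʳ g c c⁻¹ m gc≋m cc⁻¹≋I = begin
    g               ≈⟨ ≋-sym (·-identityʳ g) ⟩
    g · I           ≈⟨ ·-congˡ {g} (≋-sym cc⁻¹≋I) ⟩
    g · (c · c⁻¹)   ≈⟨ ≋-sym (·-assoc g c c⁻¹) ⟩
    (g · c) · c⁻¹   ≈⟨ ·-congʳ {B = c⁻¹} gc≋m ⟩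
    m · c⁻¹         ∎

  inverse-unique : ∀ a a⁻¹ c → a⁻¹ · a ≋ I → a · c ≋ I → c ≋ a⁻¹
  inverse-unique a a⁻¹ c a⁻¹a≋I ac≋I = begin
    c               ≈⟨ ≋-sym (·-identityˡ c) ⟩
    I · c           ≈⟨ ·-congʳ {B = c} (≋-sym a⁻¹a≋I) ⟩
    (a⁻¹ · a) · c   ≈⟨ ·-assoc a⁻¹ a c ⟩
    a⁻¹ · (a · c)   ≈⟨ ·-congˡ {a⁻¹} ac≋I ⟩
    a⁻¹ · I         ≈⟨ ·-identityʳ a⁻¹ ⟩
    a⁻¹             ∎

  involution-product-inverse : ∀ A B → A · A ≋ I → B · B ≋ I → (A · B) · (B · A) ≋ I
  involution-product-inverse A B AA≋I BB≋I = begin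
    (A · B) · (B · A) ≈⟨ ·-assoc A B (B · A) ⟩
    A · (B · (B · A)) ≈⟨ ·-congˡ {A} (≋-sym (·-assoc B B A)) ⟩
    A · ((B · B) · A) ≈⟨ ·-congˡ {A} (≋-trans (·-congʳ {B = A} BB≋I) (·-identityˡ A)) ⟩
    A · A             ≈⟨ AA≋I ⟩
    I                 ∎

module Monomials (F : FiniteField2) (l : ℕ) where
  open Inverses F l public
  open SetoidReasoning setoid

  monomial : (Idx → Idx) → (Idx → Carrier) → Mat
  monomial σ d i j = δ i (σ j) * d j

  diagonal : (Idx → Carrier) → Mat
  diagonal = monomial (λ j → j)

  monomial-cong : ∀ {σ σ′ d d′} → (∀ j → σ j ≡ σ′ j) → (∀ j → d j ≈ d′ j) → monomial σ d ≋ monomial σ′ d′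
  monomial-cong σ≗σ′ d≈d′ = mk λ i j → *-cong (reflexive (≡.cong (δ i) (σ≗σ′ j))) (d≈d′ j)

  monomial≋I : ∀ {σ d} → (∀ j → σ j ≡ j) → (∀ j → d j ≈ 1#) → monomial σ d ≋ I
  monomial≋I σ≗id d≈1 = mk λ i j → trans (*-cong (reflexive (≡.cong (δ i) (σ≗id j))) (d≈1 j)) (*-identityʳ _)

  monomial-· : ∀ σ d τ e → monomial σ d · monomial τ e ≋ monomial (λ j → σ (τ j)) (λ j → d (τ j) * e j)
  monomial-· σ d τ e = mk λ i j → begin
    Σ′ (λ k → (δ i (σ k) * d k) * (δ k (τ j) * e j))
      ≈⟨ Σ′-cong _ (λ k → (δ i (σ k) * d k * e j) * δ k (τ j))
                 (λ k → solve 4 (λ a b c x → (a :* b) :* (c :* x) := (a :* b :* x) :* c) refl (δ i (σ k)) (d k) (δ k (τ j)) (e j)) ⟩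
    Σ′ (λ k → (δ i (σ k) * d k * e j) * δ k (τ j)) ≈⟨ Σ′-δʳ (τ j) (λ k → δ i (σ k) * d k * e j) ⟩
    δ i (σ (τ j)) * d (τ j) * e j                  ≈⟨ *-assoc _ _ _ ⟩
    δ i (σ (τ j)) * (d (τ j) * e j)                ∎

  diagonal-· : ∀ d e → diagonal d · diagonal e ≋ diagonal (λ j → d j * e j)
  diagonal-· d e = monomial-· (λ j → j) d (λ j → j) e

  _^ᶠ_ : (Idx → Idx) → ℕ → Idx → Idx
  (σ ^ᶠ zero)  j = j
  (σ ^ᶠ suc m) j = σ ((σ ^ᶠ m) j)

  coeff^ : ℕ → (Idx → Idx) → (Idx → Carrier) → Idx → Carrier
  coeff^ zero    σ d j = 1#
  coeff^ (suc m) σ d j = d ((σ ^ᶠ m) j) * coeff^ m σ d j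

  monomial-^ : ∀ σ d m → monomial σ d ^ m ≋ monomial (σ ^ᶠ m) (coeff^ m σ d)
  monomial-^ σ d zero    = ≋-sym (monomial≋I (λ j → ≡.refl) (λ j → refl))
  monomial-^ σ d (suc m) = ≋-trans (·-congˡ {monomial σ d} (monomial-^ σ d m)) (monomial-· σ d (σ ^ᶠ m) (coeff^ m σ d))

  coeff^-unit : ∀ σ d → (∀ x → Unit (d x)) → ∀ m j → Unit (coeff^ m σ d j)
  coeff^-unit σ d d-unit zero    j = 1# , *-identityˡ 1#
  coeff^-unit σ d d-unit (suc m) j = Unit-* (d-unit _) (coeff^-unit σ d d-unit m j)

  involutive⇒injective : ∀ σ → (∀ j → σ (σ j) ≡ j) → Injective {A = Idx} _≡_ _≡_ σ
  involutive⇒injective σ σσ≗id {a} {b} σa≡σb = ≡.trans (≡.sym (σσ≗id a)) (≡.trans (≡.cong σ σa≡σb) (σσ≗id b))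

  δ-injective : ∀ {σ} → Injective {A = Idx} _≡_ _≡_ σ → ∀ a b → δ (σ a) (σ b) ≈ δ a b
  δ-injective {σ} σ-inj a b = by-cases (a Fin.≟ b)
    where
    by-cases : Dec (a ≡ b) → δ (σ a) (σ b) ≈ δ a b
    by-cases (yes ≡.refl) = trans (δ-refl (σ a)) (sym (δ-refl a))
    by-cases (no a≢b)     = trans (δ-≢ (λ σa≡σb → a≢b (σ-inj σa≡σb))) (sym (δ-≢ a≢b))

  monomial-row : ∀ {σ} d → Injective {A = Idx} _≡_ _≡_ σ → ∀ a j → monomial σ d (σ a) j ≈ δ j a * d a
  monomial-row d σ-inj a j = trans (*-congʳ (δ-injective σ-inj a j)) (trans (δ-subst a j d) (*-congʳ (reflexive (δ-sym a j))))

  monomial-conj-XS : ∀ σ d p q p′ q′ u → Injective {A = Idx} _≡_ _≡_ σ → σ v0 ≡ v0 → σ p ≡ p′ → σ q ≡ q′ →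
                     d v0 ≈ 1# → d p * d q ≈ 1# →
                     monomial σ d · XS p q u ≋ XS p′ q′ (u * d p) · monomial σ d
  monomial-conj-XS σ d p q p′ q′ u σ-inj σv0 σp σq dv0≈1 dpdq≈1 = mk λ i j → sym (begin
    (XS p′ q′ (u * d p) · M) i j
      ≈⟨ XS·-entry′ p′ q′ (u * d p) M i j refl (M-row-q′ j) ⟩
    M i j + (u * d p) * (δ i v0 * (δ j q * d q)) + ((u * d p) * (u * d p)) * (δ i p′ * (δ j q * d q))
      ≈⟨ regroup (M i j) u (d p) (d q) (δ i v0) (δ j q) (δ i p′) ⟩
    M i j + (u * (δ i v0 * δ j q)) * (d p * d q) + ((u * u) * (δ i p′ * d p * δ j q)) * (d p * d q)
      ≈⟨ +-cong (+-congˡ (*-congˡ dpdq≈1)) (*-congˡ dpdq≈1) ⟩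
    M i j + (u * (δ i v0 * δ j q)) * 1# + ((u * u) * (δ i p′ * d p * δ j q)) * 1#
      ≈⟨ drop-1 (M i j) u (d p) (δ i v0) (δ j q) (δ i p′) ⟩
    M i j + u * ((δ i v0 * 1#) * δ j q) + (u * u) * ((δ i p′ * d p) * δ j q)
      ≈⟨ sym (+-cong (+-congˡ (*-congˡ (*-congʳ (*-cong (reflexive (≡.cong (δ i) σv0)) dv0≈1))))
                     (*-congˡ (*-congʳ (*-congʳ (reflexive (≡.cong (δ i) σp)))))) ⟩
    M i j + u * (M i v0 * δ j q) + (u * u) * (M i p * δ j q)
      ≈⟨ sym (·XS-entry p q u M i j) ⟩
    (M · XS p q u) i j ∎)
    where
    M : Mat
    M = monomial σ d
    M-row-q′ : ∀ j → M q′ j ≈ δ j q * d q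
    M-row-q′ j = trans (reflexive (≡.cong (λ z → M z j) (≡.sym σq))) (monomial-row d σ-inj q j)
    regroup : ∀ m u dp dq b c e →
              m + (u * dp) * (b * (c * dq)) + ((u * dp) * (u * dp)) * (e * (c * dq))
              ≈ m + (u * (b * c)) * (dp * dq) + ((u * u) * (e * dp * c)) * (dp * dq)
    regroup = solve 7 (λ m u dp dq b c e → m :+ (u :* dp) :* (b :* (c :* dq)) :+ ((u :* dp) :* (u :* dp)) :* (e :* (c :* dq))
                       := m :+ (u :* (b :* c)) :* (dp :* dq) :+ ((u :* u) :* (e :* dp :* c)) :* (dp :* dq)) refl
    drop-1 : ∀ m u dp b c e →
             m + (u * (b * c)) * 1# + ((u * u) * (e * dp * c)) * 1# ≈ m + u * ((b * 1#) * c) + (u * u) * ((e * dp) * c)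
    drop-1 = solve 6 (λ m u dp b c e → m :+ (u :* (b :* c)) :* con 1 :+ ((u :* u) :* (e :* dp :* c)) :* con 1
                      := m :+ u :* ((b :* con 1) :* c) :+ (u :* u) :* ((e :* dp) :* c)) refl

  monomial-conj-XL : ∀ σ d p q′ q p′ P Q′ Q P′ u → Injective {A = Idx} _≡_ _≡_ σ → σ p ≡ P → σ q′ ≡ Q′ → σ q ≡ Q → σ p′ ≡ P′ →
                     d p * d p′ ≈ 1# → d q * d q′ ≈ 1# →
                     monomial σ d · XL p q′ q p′ u ≋ XL P Q′ Q P′ (u * d p * d q) · monomial σ d
  monomial-conj-XL σ d p q′ q p′ P Q′ Q P′ u σ-inj σp σq′ σq σp′ dpdp′≈1 dqdq′≈1 = mk λ i j → sym (begin
    (XL P Q′ Q P′ (u * d p * d q) · M) i j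
      ≈⟨ XL·-entry′ P Q′ Q P′ (u * d p * d q) M i j refl (M-row q′ Q′ σq′ j) (M-row p′ P′ σp′ j) ⟩
    M i j + (u * d p * d q) * (δ i P * (δ j q′ * d q′) + δ i Q * (δ j p′ * d p′))
      ≈⟨ regroup (M i j) u (d p) (d q) (d q′) (d p′) (δ i P) (δ j q′) (δ i Q) (δ j p′) ⟩
    M i j + u * ((δ i P * d p) * δ j q′) * (d q * d q′) + u * ((δ i Q * d q) * δ j p′) * (d p * d p′)
      ≈⟨ +-cong (+-congˡ (*-congˡ dqdq′≈1)) (*-congˡ dpdp′≈1) ⟩
    M i j + u * ((δ i P * d p) * δ j q′) * 1# + u * ((δ i Q * d q) * δ j p′) * 1#
      ≈⟨ drop-1 (M i j) u _ _ ⟩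
    M i j + u * ((δ i P * d p) * δ j q′ + (δ i Q * d q) * δ j p′)
      ≈⟨ sym (+-congˡ (*-congˡ (+-cong (*-congʳ (*-congʳ (reflexive (≡.cong (δ i) σp))))
                                       (*-congʳ (*-congʳ (reflexive (≡.cong (δ i) σq))))))) ⟩
    M i j + u * (M i p * δ j q′ + M i q * δ j p′)
      ≈⟨ sym (·XL-entry p q′ q p′ u M i j) ⟩
    (M · XL p q′ q p′ u) i j ∎)
    where
    M : Mat
    M = monomial σ d
    M-row : ∀ a A → σ a ≡ A → ∀ j → M A j ≈ δ j a * d a
    M-row a A σa≡A j = trans (reflexive (≡.cong (λ z → M z j) (≡.sym σa≡A))) (monomial-row d σ-inj a j)
    regroup : ∀ m u dp dq dq′ dp′ a b c e →
              m + (u * dp * dq) * (a * (b * dq′) + c * (e * dp′))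
              ≈ m + u * ((a * dp) * b) * (dq * dq′) + u * ((c * dq) * e) * (dp * dp′)
    regroup = solve 10 (λ m u dp dq dq′ dp′ a b c e → m :+ (u :* dp :* dq) :* (a :* (b :* dq′) :+ c :* (e :* dp′))
                        := m :+ u :* ((a :* dp) :* b) :* (dq :* dq′) :+ u :* ((c :* dq) :* e) :* (dp :* dp′)) refl
    drop-1 : ∀ m u x y → m + u * x * 1# + u * y * 1# ≈ m + u * (x + y)
    drop-1 = solve 4 (λ m u x y → m :+ u :* x :* con 1 :+ u :* y :* con 1 := m :+ u :* (x :+ y)) refl

  perm : (Idx → Idx) → Mat
  perm σ = monomial σ (λ _ → 1#)

  perm-· : ∀ σ τ → perm σ · perm τ ≋ perm (λ j → σ (τ j))
  perm-· σ τ = ≋-trans (monomial-· σ _ τ _) (monomial-cong (λ _ → ≡.refl) (λ _ → *-identityˡ 1#))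

  perm-conj-XS : ∀ σ p q p′ q′ u → Injective {A = Idx} _≡_ _≡_ σ → σ v0 ≡ v0 → σ p ≡ p′ → σ q ≡ q′ →
                 perm σ · XS p q u ≋ XS p′ q′ u · perm σ
  perm-conj-XS σ p q p′ q′ u σ-inj σv0 σp σq =
    ≋-trans (monomial-conj-XS σ _ p q p′ q′ u σ-inj σv0 σp σq refl (*-identityˡ 1#))
            (·-congʳ {B = perm σ} (XS-cong p′ q′ (*-identityʳ u)))

  perm-conj-XL : ∀ σ p q′ q p′ P Q′ Q P′ u → Injective {A = Idx} _≡_ _≡_ σ → σ p ≡ P → σ q′ ≡ Q′ → σ q ≡ Q → σ p′ ≡ P′ →
                 perm σ · XL p q′ q p′ u ≋ XL P Q′ Q P′ u · perm σ
  perm-conj-XL σ p q′ q p′ P Q′ Q P′ u σ-inj σp σq′ σq σp′ =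
    ≋-trans (monomial-conj-XL σ _ p q′ q p′ P Q′ Q P′ u σ-inj σp σq′ σq σp′ (*-identityˡ 1#) (*-identityˡ 1#))
            (·-congʳ {B = perm σ} (XL-cong P Q′ Q P′ (trans (*-identityʳ _) (*-identityʳ u))))

module WeylElements (F : FiniteField2) (l : ℕ) where
  open Monomials F l public
  open SetoidReasoning setoid

  caseAt : ∀ {A : Set} → Idx → Idx → A → A → A → Idx → A
  caseAt q p α β γ j with j Fin.≟ q | j Fin.≟ p
  ... | yes _ | _     = α
  ... | no _  | yes _ = β
  ... | no _  | no _  = γ

  caseAt-q : ∀ {A : Set} q p (α β : A) γ → caseAt q p α β γ q ≡ α
  caseAt-q q p α β γ with q Fin.≟ q
  ... | yes _   = ≡.refl
  ... | no q≢q = ⊥-elim (q≢q ≡.refl)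

  caseAt-p : ∀ {A : Set} q p (α β : A) γ → p ≢ q → caseAt q p α β γ p ≡ β
  caseAt-p q p α β γ p≢q with p Fin.≟ q | p Fin.≟ p
  ... | yes p≡q | _      = ⊥-elim (p≢q p≡q)
  ... | no _    | yes _   = ≡.refl
  ... | no _    | no p≢p = ⊥-elim (p≢p ≡.refl)

  caseAt-other : ∀ {A : Set} q p (α β : A) γ j → j ≢ q → j ≢ p → caseAt q p α β γ j ≡ γ
  caseAt-other q p α β γ j j≢q j≢p with j Fin.≟ q | j Fin.≟ p
  ... | yes j≡q | _       = ⊥-elim (j≢q j≡q)
  ... | no _    | yes j≡p = ⊥-elim (j≢p j≡p)
  ... | no _    | no _    = ≡.refl

  caseAt-≈1 : ∀ q p {α β γ} j → α ≈ 1# → β ≈ 1# → γ ≈ 1# → caseAt q p α β γ j ≈ 1#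
  caseAt-≈1 q p j α≈1 β≈1 γ≈1 with j Fin.≟ q | j Fin.≟ p
  ... | yes _ | _     = α≈1
  ... | no _  | yes _ = β≈1
  ... | no _  | no _  = γ≈1

  swap : Idx → Idx → Idx → Idx
  swap p q j = caseAt q p p q j j

  coeffˢ : Idx → Idx → Carrier → Carrier → Idx → Carrier
  coeffˢ p q u v = caseAt q p (u * u) (v * v) 1#

  swap₂ : Idx → Idx → Idx → Idx → Idx → Idx
  swap₂ p q′ q p′ j = caseAt q′ p′ p q (caseAt p q q′ p′ j j) j

  coeffˡ : Idx → Idx → Idx → Idx → Carrier → Carrier → Idx → Carrier
  coeffˡ p q′ q p′ u v j = caseAt q′ p′ u u (caseAt p q v v 1# j) j

  swap-q : ∀ p q → swap p q q ≡ p
  swap-q p q = caseAt-q q p p q q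

  swap-p : ∀ p q → p ≢ q → swap p q p ≡ q
  swap-p p q p≢q = caseAt-p q p p q p p≢q

  swap-other : ∀ p q j → j ≢ q → j ≢ p → swap p q j ≡ j
  swap-other p q j j≢q j≢p = caseAt-other q p p q j j j≢q j≢p

  coeffˢ-q : ∀ p q u v → coeffˢ p q u v q ≡ u * u
  coeffˢ-q p q u v = caseAt-q q p (u * u) (v * v) 1#

  coeffˢ-p : ∀ p q u v → p ≢ q → coeffˢ p q u v p ≡ v * v
  coeffˢ-p p q u v p≢q = caseAt-p q p (u * u) (v * v) 1# p≢q

  coeffˢ-other : ∀ p q u v j → j ≢ q → j ≢ p → coeffˢ p q u v j ≡ 1#
  coeffˢ-other p q u v j j≢q j≢p = caseAt-other q p (u * u) (v * v) 1# j j≢q j≢p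

  swap₂-q′ : ∀ p q′ q p′ → swap₂ p q′ q p′ q′ ≡ p
  swap₂-q′ p q′ q p′ = caseAt-q q′ p′ p q _

  swap₂-p′ : ∀ p q′ q p′ → p′ ≢ q′ → swap₂ p q′ q p′ p′ ≡ q
  swap₂-p′ p q′ q p′ p′≢q′ = caseAt-p q′ p′ p q _ p′≢q′

  swap₂-p : ∀ p q′ q p′ → p ≢ q′ → p ≢ p′ → swap₂ p q′ q p′ p ≡ q′
  swap₂-p p q′ q p′ p≢q′ p≢p′ = ≡.trans (caseAt-other q′ p′ p q _ p p≢q′ p≢p′) (caseAt-q p q q′ p′ p)

  swap₂-q : ∀ p q′ q p′ → q ≢ q′ → q ≢ p′ → q ≢ p → swap₂ p q′ q p′ q ≡ p′
  swap₂-q p q′ q p′ q≢q′ q≢p′ q≢p = ≡.trans (caseAt-other q′ p′ p q _ q q≢q′ q≢p′) (caseAt-p p q q′ p′ q q≢p)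

  swap₂-other : ∀ p q′ q p′ j → j ≢ q′ → j ≢ p′ → j ≢ p → j ≢ q → swap₂ p q′ q p′ j ≡ j
  swap₂-other p q′ q p′ j j≢q′ j≢p′ j≢p j≢q =
    ≡.trans (caseAt-other q′ p′ p q _ j j≢q′ j≢p′) (caseAt-other p q q′ p′ j j j≢p j≢q)

  coeffˡ-q′ : ∀ p q′ q p′ u v → coeffˡ p q′ q p′ u v q′ ≡ u
  coeffˡ-q′ p q′ q p′ u v = caseAt-q q′ p′ u u _

  coeffˡ-p′ : ∀ p q′ q p′ u v → p′ ≢ q′ → coeffˡ p q′ q p′ u v p′ ≡ u
  coeffˡ-p′ p q′ q p′ u v p′≢q′ = caseAt-p q′ p′ u u _ p′≢q′

  coeffˡ-p : ∀ p q′ q p′ u v → p ≢ q′ → p ≢ p′ → coeffˡ p q′ q p′ u v p ≡ v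
  coeffˡ-p p q′ q p′ u v p≢q′ p≢p′ = ≡.trans (caseAt-other q′ p′ u u _ p p≢q′ p≢p′) (caseAt-q p q v v 1#)

  coeffˡ-q : ∀ p q′ q p′ u v → q ≢ q′ → q ≢ p′ → q ≢ p → coeffˡ p q′ q p′ u v q ≡ v
  coeffˡ-q p q′ q p′ u v q≢q′ q≢p′ q≢p = ≡.trans (caseAt-other q′ p′ u u _ q q≢q′ q≢p′) (caseAt-p p q v v 1# q≢p)

  coeffˡ-other : ∀ p q′ q p′ u v j → j ≢ q′ → j ≢ p′ → j ≢ p → j ≢ q → coeffˡ p q′ q p′ u v j ≡ 1#
  coeffˡ-other p q′ q p′ u v j j≢q′ j≢p′ j≢p j≢q =
    ≡.trans (caseAt-other q′ p′ u u _ j j≢q′ j≢p′) (caseAt-other p q v v 1# j j≢p j≢q)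

  swap-involutive : ∀ p q → p ≢ q → ∀ j → swap p q (swap p q j) ≡ j
  swap-involutive p q p≢q j = by-cases (j Fin.≟ q) (j Fin.≟ p)
    where
    by-cases : Dec (j ≡ q) → Dec (j ≡ p) → swap p q (swap p q j) ≡ j
    by-cases (yes ≡.refl) _            = ≡.trans (≡.cong (swap p q) (swap-q p q)) (swap-p p q p≢q)
    by-cases (no _)       (yes ≡.refl) = ≡.trans (≡.cong (swap p q) (swap-p p q p≢q)) (swap-q p q)
    by-cases (no j≢q)     (no j≢p)     = ≡.trans (≡.cong (swap p q) (swap-other p q j j≢q j≢p)) (swap-other p q j j≢q j≢p)

  swap₂-involutive : ∀ p q′ q p′ → p ≢ q′ → p ≢ q → p ≢ p′ → q′ ≢ q → q′ ≢ p′ → q ≢ p′ →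
                     ∀ j → swap₂ p q′ q p′ (swap₂ p q′ q p′ j) ≡ j
  swap₂-involutive p q′ q p′ p≢q′ p≢q p≢p′ q′≢q q′≢p′ q≢p′ j = by-cases (j Fin.≟ q′) (j Fin.≟ p′) (j Fin.≟ p) (j Fin.≟ q)
    where
    σ : Idx → Idx
    σ = swap₂ p q′ q p′
    σq : σ q ≡ p′
    σq = swap₂-q p q′ q p′ (≡.≢-sym q′≢q) q≢p′ (≡.≢-sym p≢q)
    σp : σ p ≡ q′
    σp = swap₂-p p q′ q p′ p≢q′ p≢p′
    σp′ : σ p′ ≡ q
    σp′ = swap₂-p′ p q′ q p′ (≡.≢-sym q′≢p′)
    σq′ : σ q′ ≡ p
    σq′ = swap₂-q′ p q′ q p′
    by-cases : Dec (j ≡ q′) → Dec (j ≡ p′) → Dec (j ≡ p) → Dec (j ≡ q) → σ (σ j) ≡ j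
    by-cases (yes ≡.refl) _ _ _                   = ≡.trans (≡.cong σ σq′) σp
    by-cases (no _) (yes ≡.refl) _ _              = ≡.trans (≡.cong σ σp′) σq
    by-cases (no _) (no _) (yes ≡.refl) _         = ≡.trans (≡.cong σ σp) σq′
    by-cases (no _) (no _) (no _) (yes ≡.refl)    = ≡.trans (≡.cong σ σq) σp′
    by-cases (no j≢q′) (no j≢p′) (no j≢p) (no j≢q) =
      ≡.trans (≡.cong σ (swap₂-other p q′ q p′ j j≢q′ j≢p′ j≢p j≢q)) (swap₂-other p q′ q p′ j j≢q′ j≢p′ j≢p j≢q)

  monomial-entry : ∀ σ d i j {a c} → σ j ≡ a → d j ≡ c → monomial σ d i j ≈ δ i a * c
  monomial-entry σ d i j σj≡a dj≡c = *-cong (reflexive (≡.cong (δ i) σj≡a)) (reflexive dj≡c)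

  1+w≈0 : ∀ w → w ≈ 1# → 1# + w ≈ 0#
  1+w≈0 w w≈1 = trans (+-congˡ w≈1) char2

  1+w²≈0 : ∀ w → w ≈ 1# → 1# + w * w ≈ 0#
  1+w²≈0 w w≈1 = 1+w≈0 (w * w) (trans (*-cong w≈1 w≈1) (*-identityˡ 1#))

  cancel-short : ∀ a b c u v → v * u ≈ 1# →
                 (a + u * b + (u * u) * c) + v * (b * (u * u)) + (v * v) * (a * (u * u)) ≈ (u * u) * c
  cancel-short a b c u v vu≈1 = begin
    (a + u * b + (u * u) * c) + v * (b * (u * u)) + (v * v) * (a * (u * u))
      ≈⟨ solve 5 (λ a b c u v → (a :+ u :* b :+ (u :* u) :* c) :+ v :* (b :* (u :* u)) :+ (v :* v) :* (a :* (u :* u))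
                  := (u :* u) :* c :+ a :* (con 1 :+ (v :* u) :* (v :* u)) :+ u :* b :* (con 1 :+ v :* u)) refl a b c u v ⟩
    (u * u) * c + a * (1# + (v * u) * (v * u)) + u * b * (1# + v * u)
      ≈⟨ +-cong (+-congˡ (*-congˡ (1+w²≈0 _ vu≈1))) (*-congˡ (1+w≈0 _ vu≈1)) ⟩
    (u * u) * c + a * 0# + u * b * 0#
      ≈⟨ solve 4 (λ x a u b → x :+ a :* con 0 :+ u :* b :* con 0 := x) refl ((u * u) * c) a u b ⟩
    (u * u) * c ∎

  cancel-long : ∀ a b c u v → v * u ≈ 1# → (a + u * b) + v * (c * 0# + a * u) ≈ u * b
  cancel-long a b c u v vu≈1 = begin
    (a + u * b) + v * (c * 0# + a * u)
      ≈⟨ solve 5 (λ a b c u v → (a :+ u :* b) :+ v :* (c :* con 0 :+ a :* u) := u :* b :+ a :* (con 1 :+ v :* u)) refl a b c u v ⟩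
    u * b + a * (1# + v * u) ≈⟨ +-congˡ (*-congˡ (1+w≈0 _ vu≈1)) ⟩
    u * b + a * 0#           ≈⟨ trans (+-congˡ (zeroʳ a)) (+-identityʳ _) ⟩
    u * b                    ∎

  cancel-long′ : ∀ a b c u v → v * u ≈ 1# → (a + u * b) + v * (a * u + c * 0#) ≈ u * b
  cancel-long′ a b c u v vu≈1 = trans (+-congˡ (*-congˡ (+-comm _ _))) (cancel-long a b c u v vu≈1)

  drop-zeroˢ : ∀ a b c u → a + u * (b * 0#) + (u * u) * (c * 0#) ≈ a
  drop-zeroˢ = solve 4 (λ a b c u → a :+ u :* (b :* con 0) :+ (u :* u) :* (c :* con 0) := a) refl

  drop-zeroˡ : ∀ a b c u → a + u * (b * 0# + c * 0#) ≈ a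
  drop-zeroˡ = solve 4 (λ a b c u → a :+ u :* (b :* con 0 :+ c :* con 0) := a) refl

  u*0≈0 : ∀ {u a} → a ≈ 0# → u * a ≈ 0#
  u*0≈0 {u} a≈0 = trans (*-congˡ a≈0) (zeroʳ u)

  -- With v = -u⁻¹, the product is n_r(u) = x_r(u) x_{-r}(v) x_r(u) for a short root r.
  module ShortWeyl (p q : Idx) (u v : Carrier) (p≢q : p ≢ q) (p≢v0 : p ≢ v0) (q≢v0 : q ≢ v0) (vu≈1 : v * u ≈ 1#) where
    X B : Mat
    X = XS p q u
    B = XS q p v · X

    X-col-q : ∀ k → X k q ≈ δ k q + u * δ k v0 + (u * u) * δ k p
    X-col-q k = +-cong (+-congˡ (*-congˡ (trans (*-congˡ (δ-refl q)) (*-identityʳ _)))) (*-congˡ (trans (*-congˡ (δ-refl q)) (*-identityʳ _)))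

    X-col-fixed : ∀ k j → j ≢ q → X k j ≈ δ k j
    X-col-fixed k j j≢q = trans (+-cong (+-congˡ (*-congˡ (*-congˡ (δ-≢ j≢q)))) (*-congˡ (*-congˡ (δ-≢ j≢q)))) (drop-zeroˢ (δ k j) (δ k v0) (δ k p) u)

    B-col-q : ∀ k → B k q ≈ (u * u) * δ k p
    B-col-q k = begin
      B k q ≈⟨ XS·-entry′ q p v X k q (X-col-q k) X-pq ⟩
      (δ k q + u * δ k v0 + (u * u) * δ k p) + v * (δ k v0 * (u * u)) + (v * v) * (δ k q * (u * u))
        ≈⟨ cancel-short (δ k q) (δ k v0) (δ k p) u v vu≈1 ⟩
      (u * u) * δ k p ∎
      where
      X-pq : X p q ≈ u * u
      X-pq = trans (X-col-q p) (trans (+-cong (+-cong (δ-≢ p≢q) (*-congˡ (δ-≢ p≢v0))) (*-congˡ (δ-refl p)))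
                                      (solve 1 (λ u → con 0 :+ u :* con 0 :+ (u :* u) :* con 1 := u :* u) refl u))

    B-col-p : ∀ k → B k p ≈ δ k p + v * δ k v0 + (v * v) * δ k q
    B-col-p k = trans (XS·-entry′ q p v X k p (X-col-fixed k p p≢q) (trans (X-col-fixed p p p≢q) (δ-refl p)))
                      (+-cong (+-congˡ (*-congˡ (*-identityʳ _))) (*-congˡ (*-identityʳ _)))

    B-col-fixed : ∀ k j → j ≢ q → j ≢ p → B k j ≈ δ k j
    B-col-fixed k j j≢q j≢p =
      trans (XS·-entry′ q p v X k j (X-col-fixed k j j≢q) (trans (X-col-fixed p j j≢q) (δ-≢ (≡.≢-sym j≢p))))
            (drop-zeroˢ (δ k j) (δ k v0) (δ k q) v)

    product-col-q : ∀ i → (X · B) i q ≈ monomial (swap p q) (coeffˢ p q u v) i q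
    product-col-q i = begin
      (X · B) i q
        ≈⟨ XS·-entry′ p q u B i q (B-col-q i) (trans (B-col-q q) (trans (*-congˡ (δ-≢ (≡.≢-sym p≢q))) (zeroʳ _))) ⟩
      (u * u) * δ i p + u * (δ i v0 * 0#) + (u * u) * (δ i p * 0#) ≈⟨ drop-zeroˢ _ _ _ u ⟩
      (u * u) * δ i p                                              ≈⟨ *-comm _ _ ⟩
      δ i p * (u * u)                                              ≈⟨ sym (monomial-entry (swap p q) (coeffˢ p q u v) i q (swap-q p q) (coeffˢ-q p q u v)) ⟩
      monomial (swap p q) (coeffˢ p q u v) i q ∎

    product-col-p : ∀ i → (X · B) i p ≈ monomial (swap p q) (coeffˢ p q u v) i p
    product-col-p i = begin
      (X · B) i p ≈⟨ XS·-entry′ p q u B i p (B-col-p i) B-qp ⟩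
      (δ i p + v * δ i v0 + (v * v) * δ i q) + u * (δ i v0 * (v * v)) + (u * u) * (δ i p * (v * v))
        ≈⟨ cancel-short (δ i p) (δ i v0) (δ i q) v u (trans (*-comm u v) vu≈1) ⟩
      (v * v) * δ i q ≈⟨ *-comm _ _ ⟩
      δ i q * (v * v) ≈⟨ sym (monomial-entry (swap p q) (coeffˢ p q u v) i p (swap-p p q p≢q) (coeffˢ-p p q u v p≢q)) ⟩
      monomial (swap p q) (coeffˢ p q u v) i p ∎
      where
      B-qp : B q p ≈ v * v
      B-qp = trans (B-col-p q) (trans (+-cong (+-cong (δ-≢ (≡.≢-sym p≢q)) (*-congˡ (δ-≢ q≢v0))) (*-congˡ (δ-refl q)))
                                      (solve 1 (λ u → con 0 :+ u :* con 0 :+ (u :* u) :* con 1 := u :* u) refl v))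

    product-col-fixed : ∀ i j → j ≢ q → j ≢ p → (X · B) i j ≈ monomial (swap p q) (coeffˢ p q u v) i j
    product-col-fixed i j j≢q j≢p = begin
      (X · B) i j
        ≈⟨ XS·-entry′ p q u B i j (B-col-fixed i j j≢q j≢p) (trans (B-col-fixed q j j≢q j≢p) (δ-≢ (≡.≢-sym j≢q))) ⟩
      δ i j + u * (δ i v0 * 0#) + (u * u) * (δ i p * 0#) ≈⟨ drop-zeroˢ _ _ _ u ⟩
      δ i j                                              ≈⟨ sym (*-identityʳ _) ⟩
      δ i j * 1#                                         ≈⟨ sym (monomial-entry (swap p q) (coeffˢ p q u v) i j (swap-other p q j j≢q j≢p) (coeffˢ-other p q u v j j≢q j≢p)) ⟩
      monomial (swap p q) (coeffˢ p q u v) i j ∎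

    product≋monomial : X · B ≋ monomial (swap p q) (coeffˢ p q u v)
    product≋monomial = mk λ i j → entry i j (j Fin.≟ q) (j Fin.≟ p)
      where
      entry : ∀ i j → Dec (j ≡ q) → Dec (j ≡ p) → (X · B) i j ≈ monomial (swap p q) (coeffˢ p q u v) i j
      entry i j (yes ≡.refl) _ = product-col-q i
      entry i j (no _) (yes ≡.refl) = product-col-p i
      entry i j (no j≢q) (no j≢p) = product-col-fixed i j j≢q j≢p

  -- With v = -u⁻¹, the product is n_r(u) = x_r(u) x_{-r}(v) x_r(u) for a long root r.
  module LongWeyl (p q′ q p′ : Idx) (u v : Carrier)
    (p≢q′ : p ≢ q′) (p≢q : p ≢ q) (p≢p′ : p ≢ p′) (q′≢q : q′ ≢ q) (q′≢p′ : q′ ≢ p′) (q≢p′ : q ≢ p′)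
    (vu≈1 : v * u ≈ 1#) where
    X B : Mat
    X = XL p q′ q p′ u
    B = XL p′ q q′ p v · X
    σ : Idx → Idx
    σ = swap₂ p q′ q p′
    d : Idx → Carrier
    d = coeffˡ p q′ q p′ u v

    X-col-fixed : ∀ k j → j ≢ q′ → j ≢ p′ → X k j ≈ δ k j
    X-col-fixed k j j≢q′ j≢p′ =
      trans (+-congˡ (*-congˡ (+-cong (*-congˡ (δ-≢ j≢q′)) (*-congˡ (δ-≢ j≢p′))))) (drop-zeroˡ (δ k j) (δ k p) (δ k q) u)

    X-col-q′ : ∀ k → X k q′ ≈ δ k q′ + u * δ k p
    X-col-q′ k = +-congˡ (*-congˡ (trans (+-cong (*-congˡ (δ-refl q′)) (*-congˡ (δ-≢ q′≢p′)))
                                         (solve 2 (λ a b → a :* con 1 :+ b :* con 0 := a) refl (δ k p) (δ k q))))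

    X-col-p′ : ∀ k → X k p′ ≈ δ k p′ + u * δ k q
    X-col-p′ k = +-congˡ (*-congˡ (trans (+-cong (*-congˡ (δ-≢ (≡.≢-sym q′≢p′))) (*-congˡ (δ-refl p′)))
                                         (solve 2 (λ a b → a :* con 0 :+ b :* con 1 := b) refl (δ k p) (δ k q))))

    X-qq′ : X q q′ ≈ 0#
    X-qq′ = trans (X-col-q′ q) (trans (+-cong (δ-≢ (≡.≢-sym q′≢q)) (*-congˡ (δ-≢ (≡.≢-sym p≢q)))) (trans (+-identityˡ _) (zeroʳ u)))
    X-pq′ : X p q′ ≈ u
    X-pq′ = trans (X-col-q′ p) (trans (+-cong (δ-≢ p≢q′) (*-congˡ (δ-refl p))) (trans (+-identityˡ _) (*-identityʳ u)))
    X-qp′ : X q p′ ≈ u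
    X-qp′ = trans (X-col-p′ q) (trans (+-cong (δ-≢ q≢p′) (*-congˡ (δ-refl q))) (trans (+-identityˡ _) (*-identityʳ u)))
    X-pp′ : X p p′ ≈ 0#
    X-pp′ = trans (X-col-p′ p) (trans (+-cong (δ-≢ p≢p′) (*-congˡ (δ-≢ p≢q))) (trans (+-identityˡ _) (zeroʳ u)))

    X-col-p : ∀ k → X k p ≈ δ k p
    X-col-p k = X-col-fixed k p p≢q′ p≢p′
    X-col-q : ∀ k → X k q ≈ δ k q
    X-col-q k = X-col-fixed k q (≡.≢-sym q′≢q) q≢p′

    B-col-q′ : ∀ k → B k q′ ≈ u * δ k p
    B-col-q′ k = trans (XL·-entry′ p′ q q′ p v X k q′ (X-col-q′ k) X-qq′ X-pq′) (cancel-long (δ k q′) (δ k p) (δ k p′) u v vu≈1)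

    B-col-p′ : ∀ k → B k p′ ≈ u * δ k q
    B-col-p′ k = trans (XL·-entry′ p′ q q′ p v X k p′ (X-col-p′ k) X-qp′ X-pp′) (cancel-long′ (δ k p′) (δ k q) (δ k q′) u v vu≈1)

    B-col-p : ∀ k → B k p ≈ δ k p + v * δ k q′
    B-col-p k = trans (XL·-entry′ p′ q q′ p v X k p (X-col-p k) (trans (X-col-p q) (δ-≢ (≡.≢-sym p≢q))) (trans (X-col-p p) (δ-refl p)))
                      (+-congˡ (*-congˡ (solve 2 (λ a b → a :* con 0 :+ b :* con 1 := b) refl (δ k p′) (δ k q′))))

    B-col-q : ∀ k → B k q ≈ δ k q + v * δ k p′
    B-col-q k = trans (XL·-entry′ p′ q q′ p v X k q (X-col-q k) (trans (X-col-q q) (δ-refl q)) (trans (X-col-q p) (δ-≢ p≢q)))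
                      (+-congˡ (*-congˡ (solve 2 (λ a b → a :* con 1 :+ b :* con 0 := a) refl (δ k p′) (δ k q′))))

    B-col-fixed : ∀ k j → j ≢ q′ → j ≢ p′ → j ≢ p → j ≢ q → B k j ≈ δ k j
    B-col-fixed k j j≢q′ j≢p′ j≢p j≢q =
      trans (XL·-entry′ p′ q q′ p v X k j (X-col-fixed k j j≢q′ j≢p′)
                        (trans (X-col-fixed q j j≢q′ j≢p′) (δ-≢ (≡.≢-sym j≢q))) (trans (X-col-fixed p j j≢q′ j≢p′) (δ-≢ (≡.≢-sym j≢p))))
            (drop-zeroˡ (δ k j) (δ k p′) (δ k q′) v)

    product-col-q′ : ∀ i → (X · B) i q′ ≈ monomial σ d i q′
    product-col-q′ i = begin
      (X · B) i q′
        ≈⟨ XL·-entry′ p q′ q p′ u B i q′ (B-col-q′ i) (trans (B-col-q′ q′) (u*0≈0 (δ-≢ (≡.≢-sym p≢q′))))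
                                                       (trans (B-col-q′ p′) (u*0≈0 (δ-≢ (≡.≢-sym p≢p′)))) ⟩
      u * δ i p + u * (δ i p * 0# + δ i q * 0#) ≈⟨ drop-zeroˡ _ _ _ u ⟩
      u * δ i p                                 ≈⟨ *-comm _ _ ⟩
      δ i p * u                                 ≈⟨ sym (monomial-entry σ d i q′ (swap₂-q′ p q′ q p′) (coeffˡ-q′ p q′ q p′ u v)) ⟩
      monomial σ d i q′ ∎

    product-col-p′ : ∀ i → (X · B) i p′ ≈ monomial σ d i p′
    product-col-p′ i = begin
      (X · B) i p′
        ≈⟨ XL·-entry′ p q′ q p′ u B i p′ (B-col-p′ i) (trans (B-col-p′ q′) (u*0≈0 (δ-≢ q′≢q)))
                                                       (trans (B-col-p′ p′) (u*0≈0 (δ-≢ (≡.≢-sym q≢p′)))) ⟩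
      u * δ i q + u * (δ i p * 0# + δ i q * 0#) ≈⟨ drop-zeroˡ _ _ _ u ⟩
      u * δ i q                                 ≈⟨ *-comm _ _ ⟩
      δ i q * u                                 ≈⟨ sym (monomial-entry σ d i p′ (swap₂-p′ p q′ q p′ (≡.≢-sym q′≢p′)) (coeffˡ-p′ p q′ q p′ u v (≡.≢-sym q′≢p′))) ⟩
      monomial σ d i p′ ∎

    product-col-p : ∀ i → (X · B) i p ≈ monomial σ d i p
    product-col-p i = begin
      (X · B) i p
        ≈⟨ XL·-entry′ p q′ q p′ u B i p (B-col-p i)
             (trans (B-col-p q′) (trans (+-cong (δ-≢ (≡.≢-sym p≢q′)) (*-congˡ (δ-refl q′))) (trans (+-identityˡ _) (*-identityʳ v))))
             (trans (B-col-p p′) (trans (+-cong (δ-≢ (≡.≢-sym p≢p′)) (*-congˡ (δ-≢ (≡.≢-sym q′≢p′)))) (trans (+-identityˡ _) (zeroʳ v)))) ⟩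
      (δ i p + v * δ i q′) + u * (δ i p * v + δ i q * 0#)
        ≈⟨ cancel-long′ (δ i p) (δ i q′) (δ i q) v u (trans (*-comm u v) vu≈1) ⟩
      v * δ i q′ ≈⟨ *-comm _ _ ⟩
      δ i q′ * v ≈⟨ sym (monomial-entry σ d i p (swap₂-p p q′ q p′ p≢q′ p≢p′) (coeffˡ-p p q′ q p′ u v p≢q′ p≢p′)) ⟩
      monomial σ d i p ∎

    product-col-q : ∀ i → (X · B) i q ≈ monomial σ d i q
    product-col-q i = begin
      (X · B) i q
        ≈⟨ XL·-entry′ p q′ q p′ u B i q (B-col-q i)
             (trans (B-col-q q′) (trans (+-cong (δ-≢ q′≢q) (*-congˡ (δ-≢ q′≢p′))) (trans (+-identityˡ _) (zeroʳ v))))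
             (trans (B-col-q p′) (trans (+-cong (δ-≢ (≡.≢-sym q≢p′)) (*-congˡ (δ-refl p′))) (trans (+-identityˡ _) (*-identityʳ v)))) ⟩
      (δ i q + v * δ i p′) + u * (δ i p * 0# + δ i q * v)
        ≈⟨ cancel-long (δ i q) (δ i p′) (δ i p) v u (trans (*-comm u v) vu≈1) ⟩
      v * δ i p′ ≈⟨ *-comm _ _ ⟩
      δ i p′ * v ≈⟨ sym (monomial-entry σ d i q (swap₂-q p q′ q p′ (≡.≢-sym q′≢q) q≢p′ (≡.≢-sym p≢q))
                                        (coeffˡ-q p q′ q p′ u v (≡.≢-sym q′≢q) q≢p′ (≡.≢-sym p≢q))) ⟩
      monomial σ d i q ∎

    product-col-fixed : ∀ i j → j ≢ q′ → j ≢ p′ → j ≢ p → j ≢ q → (X · B) i j ≈ monomial σ d i j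
    product-col-fixed i j j≢q′ j≢p′ j≢p j≢q = begin
      (X · B) i j
        ≈⟨ XL·-entry′ p q′ q p′ u B i j (B-col-fixed i j j≢q′ j≢p′ j≢p j≢q)
             (trans (B-col-fixed q′ j j≢q′ j≢p′ j≢p j≢q) (δ-≢ (≡.≢-sym j≢q′)))
             (trans (B-col-fixed p′ j j≢q′ j≢p′ j≢p j≢q) (δ-≢ (≡.≢-sym j≢p′))) ⟩
      δ i j + u * (δ i p * 0# + δ i q * 0#) ≈⟨ drop-zeroˡ _ _ _ u ⟩
      δ i j                                 ≈⟨ sym (*-identityʳ _) ⟩
      δ i j * 1#                            ≈⟨ sym (monomial-entry σ d i j (swap₂-other p q′ q p′ j j≢q′ j≢p′ j≢p j≢q)
                                                                   (coeffˡ-other p q′ q p′ u v j j≢q′ j≢p′ j≢p j≢q)) ⟩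
      monomial σ d i j ∎

    product≋monomial : X · B ≋ monomial σ d
    product≋monomial = mk λ i j → entry i j (j Fin.≟ q′) (j Fin.≟ p′) (j Fin.≟ p) (j Fin.≟ q)
      where
      entry : ∀ i j → Dec (j ≡ q′) → Dec (j ≡ p′) → Dec (j ≡ p) → Dec (j ≡ q) → (X · B) i j ≈ monomial σ d i j
      entry i j (yes ≡.refl) _ _ _ = product-col-q′ i
      entry i j (no _) (yes ≡.refl) _ _ = product-col-p′ i
      entry i j (no _) (no _) (yes ≡.refl) _ = product-col-p i
      entry i j (no _) (no _) (no _) (yes ≡.refl) = product-col-q i
      entry i j (no j≢q′) (no j≢p′) (no j≢p) (no j≢q) = product-col-fixed i j j≢q′ j≢p′ j≢p j≢q

  nR-short-monomial : ∀ a i u → ¬ u ≈ 0# →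
    nR (sh a i) u ≋ monomial (swap (vec a i) (vec (flipS a) i)) (coeffˢ (vec a i) (vec (flipS a) i) u (- (u ⁻¹)))
  -- Splitting on the sign lets flipS (flipS a) reduce to a.
  nR-short-monomial plus i u u≉0 =
    ShortWeyl.product≋monomial _ _ u (- (u ⁻¹)) (vec≢flip plus i) (vec≢v0 plus i) (vec≢v0 minus i) (-⁻¹-inverseˡ u u≉0)
  nR-short-monomial minus i u u≉0 =
    ShortWeyl.product≋monomial _ _ u (- (u ⁻¹)) (vec≢flip minus i) (vec≢v0 minus i) (vec≢v0 plus i) (-⁻¹-inverseˡ u u≉0)

  nR-long-monomial : ∀ a i b j (i≢j : i ≢ j) u → ¬ u ≈ 0# →
    nR (lg a i b j i≢j) u ≋ monomial (swap₂ (vec a i) (vec (flipS b) j) (vec b j) (vec (flipS a) i))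
                                      (coeffˡ (vec a i) (vec (flipS b) j) (vec b j) (vec (flipS a) i) u (- (u ⁻¹)))
  nR-long-monomial plus i plus j i≢j u u≉0 =
    LongWeyl.product≋monomial _ _ _ _ u (- (u ⁻¹)) p≢q′ p≢q p≢p′ q′≢q q′≢p′ q≢p′ (-⁻¹-inverseˡ u u≉0)
    where open LongRootVectors plus i plus j i≢j
  nR-long-monomial plus i minus j i≢j u u≉0 =
    LongWeyl.product≋monomial _ _ _ _ u (- (u ⁻¹)) p≢q′ p≢q p≢p′ q′≢q q′≢p′ q≢p′ (-⁻¹-inverseˡ u u≉0)
    where open LongRootVectors plus i minus j i≢j
  nR-long-monomial minus i plus j i≢j u u≉0 =
    LongWeyl.product≋monomial _ _ _ _ u (- (u ⁻¹)) p≢q′ p≢q p≢p′ q′≢q q′≢p′ q≢p′ (-⁻¹-inverseˡ u u≉0)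
    where open LongRootVectors minus i plus j i≢j
  nR-long-monomial minus i minus j i≢j u u≉0 =
    LongWeyl.product≋monomial _ _ _ _ u (- (u ⁻¹)) p≢q′ p≢q p≢p′ q′≢q q′≢p′ q≢p′ (-⁻¹-inverseˡ u u≉0)
    where open LongRootVectors minus i minus j i≢j

  coeffˢ-≈1 : ∀ p q {u v} → u ≈ 1# → v ≈ 1# → ∀ j → coeffˢ p q u v j ≈ 1#
  coeffˢ-≈1 p q u≈1 v≈1 j = caseAt-≈1 q p j (trans (*-cong u≈1 u≈1) (*-identityˡ 1#)) (trans (*-cong v≈1 v≈1) (*-identityˡ 1#)) refl

  coeffˡ-≈1 : ∀ p q′ q p′ {u v} → u ≈ 1# → v ≈ 1# → ∀ j → coeffˡ p q′ q p′ u v j ≈ 1#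
  coeffˡ-≈1 p q′ q p′ u≈1 v≈1 j = caseAt-≈1 q′ p′ j u≈1 u≈1 (caseAt-≈1 p q j v≈1 v≈1 refl)

  -- The diagonal of an element of the split torus of SO(2l+1): it fixes v0 and preserves the pairing
  -- of v_{+i} with v_{-i}.
  record Paired (d : Idx → Carrier) : Set where
    field
      at-v0   : d v0 ≈ 1#
      at-flip : ∀ x → d x * d (flipV x) ≈ 1#
  open Paired public

  Toral : Mat → Set
  Toral h = Σ (Idx → Carrier) λ d → Paired d × h ≋ diagonal d

  Paired-* : ∀ {d e} → Paired d → Paired e → Paired (λ j → d j * e j)
  Paired-* {d} {e} pd pe = record
    { at-v0   = trans (*-cong (at-v0 pd) (at-v0 pe)) (*-identityˡ 1#)
    ; at-flip = λ x → trans (*-interchange (d x) (e x) (d (flipV x)) (e (flipV x)))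
                            (trans (*-cong (at-flip pd x) (at-flip pe x)) (*-identityˡ 1#))
    }

  Toral-I : Toral I
  Toral-I = (λ _ → 1#) , record { at-v0 = refl ; at-flip = λ _ → *-identityˡ 1# } , ≋-sym (monomial≋I (λ _ → ≡.refl) (λ _ → refl))

  Toral-· : ∀ {g h} → Toral g → Toral h → Toral (g · h)
  Toral-· (d , pd , g≋d) (e , pe , h≋e) = (λ j → d j * e j) , Paired-* pd pe , ≋-trans (·-cong g≋d h≋e) (diagonal-· d e)

  -- In hR r u = nR r u · nR r (-1) both factors permute by the same involution, and the second has
  -- all coefficients 1 because -1 = 1.
  involution-square : ∀ σ d d′ → (∀ j → σ (σ j) ≡ j) → (∀ j → d′ j ≈ 1#) →
                      monomial σ d · monomial σ d′ ≋ diagonal (λ j → d (σ j))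
  involution-square σ d d′ σσ≗id d′≈1 =
    ≋-trans (monomial-· σ d σ d′) (monomial-cong σσ≗id (λ j → trans (*-congˡ (d′≈1 j)) (*-identityʳ _)))

  uu*vv≈1 : ∀ {u v} → v * u ≈ 1# → (u * u) * (v * v) ≈ 1#
  uu*vv≈1 {u} {v} vu≈1 = trans (solve 2 (λ u v → (u :* u) :* (v :* v) := (v :* u) :* (v :* u)) refl u v)
                                (trans (*-cong vu≈1 vu≈1) (*-identityˡ 1#))

  hR-short-toral : ∀ a i u → ¬ u ≈ 0# → Toral (hR (sh a i) u)
  hR-short-toral a i u u≉0 =
    D , paired ,
    ≋-trans (·-cong (nR-short-monomial a i u u≉0) (nR-short-monomial a i (- 1#) -1≉0))
            (involution-square σ d _ (swap-involutive p q p≢q) (coeffˢ-≈1 p q -1≈1 -[-1]⁻¹≈1))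
    where
    p q : Idx
    p = vec a i
    q = vec (flipS a) i
    p≢q : p ≢ q
    p≢q = vec≢flip a i
    v : Carrier
    v = - (u ⁻¹)
    σ : Idx → Idx
    σ = swap p q
    d D : Idx → Carrier
    d = coeffˢ p q u v
    D x = d (σ x)
    D-other : ∀ x → x ≢ q → x ≢ p → D x ≈ 1#
    D-other x x≢q x≢p = reflexive (≡.trans (≡.cong d (swap-other p q x x≢q x≢p)) (coeffˢ-other p q u v x x≢q x≢p))
    D-p : D p ≡ u * u
    D-p = ≡.trans (≡.cong d (swap-p p q p≢q)) (coeffˢ-q p q u v)
    D-q : D q ≡ v * v
    D-q = ≡.trans (≡.cong d (swap-q p q)) (coeffˢ-p p q u v p≢q)
    flip-p : flipV p ≡ q
    flip-p = flipV-vec a i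
    flip-q : flipV q ≡ p
    flip-q = flipV-flip a i
    paired : Paired D
    paired = record { at-v0 = D-other v0 (≡.≢-sym (vec≢v0 (flipS a) i)) (≡.≢-sym (vec≢v0 a i)) ; at-flip = at-flip′ }
      where
      at-flip′ : ∀ x → D x * D (flipV x) ≈ 1#
      at-flip′ x = by-cases (x Fin.≟ q) (x Fin.≟ p)
        where
        by-cases : Dec (x ≡ q) → Dec (x ≡ p) → D x * D (flipV x) ≈ 1#
        by-cases (yes ≡.refl) _ = trans (reflexive (≡.cong₂ _*_ D-q (≡.trans (≡.cong D flip-q) D-p)))
                                          (trans (*-comm _ _) (uu*vv≈1 (-⁻¹-inverseˡ u u≉0)))
        by-cases (no _) (yes ≡.refl) = trans (reflexive (≡.cong₂ _*_ D-p (≡.trans (≡.cong D flip-p) D-q))) (uu*vv≈1 (-⁻¹-inverseˡ u u≉0))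
        by-cases (no x≢q) (no x≢p) =
          trans (*-cong (D-other x x≢q x≢p)
                        (D-other (flipV x) (λ e → x≢p (flipV-transpose flip-q e)) (λ e → x≢q (flipV-transpose flip-p e))))
                (*-identityˡ 1#)

  hR-long-toral : ∀ a i b j (i≢j : i ≢ j) u → ¬ u ≈ 0# → Toral (hR (lg a i b j i≢j) u)
  hR-long-toral a i b j i≢j u u≉0 =
    D , paired ,
    ≋-trans (·-cong (nR-long-monomial a i b j i≢j u u≉0) (nR-long-monomial a i b j i≢j (- 1#) -1≉0))
            (involution-square σ d _ (swap₂-involutive p q′ q p′ p≢q′ p≢q p≢p′ q′≢q q′≢p′ q≢p′) (coeffˡ-≈1 p q′ q p′ -1≈1 -[-1]⁻¹≈1))
    where
    open LongRootVectors a i b j i≢j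
    v : Carrier
    v = - (u ⁻¹)
    σ : Idx → Idx
    σ = swap₂ p q′ q p′
    d D : Idx → Carrier
    d = coeffˡ p q′ q p′ u v
    D x = d (σ x)
    vu≈1 : v * u ≈ 1#
    vu≈1 = -⁻¹-inverseˡ u u≉0
    uv≈1 : u * v ≈ 1#
    uv≈1 = trans (*-comm u v) vu≈1
    D-q′ : D q′ ≈ v
    D-q′ = reflexive (≡.trans (≡.cong d (swap₂-q′ p q′ q p′)) (coeffˡ-p p q′ q p′ u v p≢q′ p≢p′))
    D-p′ : D p′ ≈ v
    D-p′ = reflexive (≡.trans (≡.cong d (swap₂-p′ p q′ q p′ (≡.≢-sym q′≢p′))) (coeffˡ-q p q′ q p′ u v (≡.≢-sym q′≢q) q≢p′ (≡.≢-sym p≢q)))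
    D-p : D p ≈ u
    D-p = reflexive (≡.trans (≡.cong d (swap₂-p p q′ q p′ p≢q′ p≢p′)) (coeffˡ-q′ p q′ q p′ u v))
    D-q : D q ≈ u
    D-q = reflexive (≡.trans (≡.cong d (swap₂-q p q′ q p′ (≡.≢-sym q′≢q) q≢p′ (≡.≢-sym p≢q))) (coeffˡ-p′ p q′ q p′ u v (≡.≢-sym q′≢p′)))
    D-other : ∀ x → x ≢ q′ → x ≢ p′ → x ≢ p → x ≢ q → D x ≈ 1#
    D-other x x≢q′ x≢p′ x≢p x≢q =
      reflexive (≡.trans (≡.cong d (swap₂-other p q′ q p′ x x≢q′ x≢p′ x≢p x≢q)) (coeffˡ-other p q′ q p′ u v x x≢q′ x≢p′ x≢p x≢q))
    flip-p : flipV p ≡ p′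
    flip-p = flipV-vec a i
    flip-p′ : flipV p′ ≡ p
    flip-p′ = flipV-flip a i
    flip-q : flipV q ≡ q′
    flip-q = flipV-vec b j
    flip-q′ : flipV q′ ≡ q
    flip-q′ = flipV-flip b j
    paired : Paired D
    paired = record
      { at-v0   = D-other v0 (≡.≢-sym (vec≢v0 _ j)) (≡.≢-sym (vec≢v0 _ i)) (≡.≢-sym (vec≢v0 a i)) (≡.≢-sym (vec≢v0 b j))
      ; at-flip = at-flip′
      }
      where
      at-flip′ : ∀ x → D x * D (flipV x) ≈ 1#
      at-flip′ x = by-cases (x Fin.≟ q′) (x Fin.≟ p′) (x Fin.≟ p) (x Fin.≟ q)
        where
        by-cases : Dec (x ≡ q′) → Dec (x ≡ p′) → Dec (x ≡ p) → Dec (x ≡ q) → D x * D (flipV x) ≈ 1#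
        by-cases (yes ≡.refl) _ _ _             = trans (*-cong D-q′ (trans (reflexive (≡.cong D flip-q′)) D-q)) vu≈1
        by-cases (no _) (yes ≡.refl) _ _        = trans (*-cong D-p′ (trans (reflexive (≡.cong D flip-p′)) D-p)) vu≈1
        by-cases (no _) (no _) (yes ≡.refl) _   = trans (*-cong D-p (trans (reflexive (≡.cong D flip-p)) D-p′)) uv≈1
        by-cases (no _) (no _) (no _) (yes ≡.refl) = trans (*-cong D-q (trans (reflexive (≡.cong D flip-q)) D-q′)) uv≈1
        by-cases (no x≢q′) (no x≢p′) (no x≢p) (no x≢q) =
          trans (*-cong (D-other x x≢q′ x≢p′ x≢p x≢q)
                    (D-other (flipV x) (λ e → x≢q (flipV-transpose flip-q′ e)) (λ e → x≢p (flipV-transpose flip-p′ e))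
                                       (λ e → x≢p′ (flipV-transpose flip-p e)) (λ e → x≢q′ (flipV-transpose flip-q e))))
            (*-identityˡ 1#)

  hR-toral : ∀ r u → ¬ u ≈ 0# → Toral (hR r u)
  hR-toral (sh a i)         = hR-short-toral a i
  hR-toral (lg a i b j i≢j) = hR-long-toral a i b j i≢j

  InH-toral : ∀ h → InH h → Toral h
  InH-toral h (hs , Hhs , ∏hs≈h) = Toral-cong (mk ∏hs≈h) (prod-toral hs Hhs)
    where
    Toral-cong : ∀ {g h} → g ≋ h → Toral g → Toral h
    Toral-cong g≋h (d , pd , g≋d) = d , pd , ≋-trans (≋-sym g≋h) g≋d
    prod-toral : ∀ hs → All HGen hs → Toral (prod hs)
    prod-toral []       []                                 = Toral-I
    prod-toral (_ ∷ hs) ((r , u , u≉0 , ≡.refl) ∷ Hhs) = Toral-· (hR-toral r u u≉0) (prod-toral hs Hhs)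

module CoxeterElement (F : FiniteField2) (n : ℕ) where
  open WeylElements F (suc (suc n)) public
  open Setup F n public using (l; nProd; KbGen; InKb; Sb; Conn)

  ρ₀ : Idx → Idx
  ρ₀ = swap (vec plus Fin.zero) (vec minus Fin.zero)

  -- ρ k is the reflection in r_(k+2); it exchanges the basis vectors with (0-based) indices k and k+1.
  ρ : Fin (suc n) → Idx → Idx
  ρ k = swap₂ (vec plus (Fin.suc k)) (vec plus (inject₁ k)) (vec minus (inject₁ k)) (vec minus (Fin.suc k))

  n₀≋perm : nR (simpleRoot Fin.zero) 1# ≋ perm ρ₀
  n₀≋perm = ≋-trans (nR-short-monomial plus Fin.zero 1# 1≉0) (monomial-cong (λ _ → ≡.refl) (coeffˢ-≈1 _ _ refl -1⁻¹≈1))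

  suc≢inject₁ : ∀ (k : Fin (suc n)) → Fin.suc k ≢ inject₁ k
  suc≢inject₁ k e = ℕₚ.1+n≢n (≡.trans (≡.cong toℕ e) (Finₚ.toℕ-inject₁ k))

  nₖ≋perm : ∀ k → nR (simpleRoot (Fin.suc k)) 1# ≋ perm (ρ k)
  nₖ≋perm k = ≋-trans (nR-long-monomial plus (Fin.suc k) minus (inject₁ k) (suc≢inject₁ k) 1# 1≉0)
                      (monomial-cong (λ _ → ≡.refl) (coeffˡ-≈1 _ _ _ _ refl -1⁻¹≈1))

  ρ₀-involutive : ∀ j → ρ₀ (ρ₀ j) ≡ j
  ρ₀-involutive = swap-involutive (vec plus Fin.zero) (vec minus Fin.zero) (vec≢flip plus Fin.zero)

  ρ₀-v0 : ρ₀ v0 ≡ v0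
  ρ₀-v0 = swap-other (vec plus Fin.zero) (vec minus Fin.zero) v0 (λ ()) (λ ())

  ρ₀-e₀ : ∀ s → ρ₀ (vec s Fin.zero) ≡ vec (flipS s) Fin.zero
  ρ₀-e₀ plus  = swap-p (vec plus Fin.zero) (vec minus Fin.zero) (vec≢flip plus Fin.zero)
  ρ₀-e₀ minus = swap-q (vec plus Fin.zero) (vec minus Fin.zero)

  ρ₀-other : ∀ s c → toℕ c ≢ 0 → ρ₀ (vec s c) ≡ vec s c
  ρ₀-other s c c≢0 = swap-other (vec plus Fin.zero) (vec minus Fin.zero) (vec s c) (λ e → c≢0 (≡.cong toℕ (vec-injectiveⁱ {s} {minus} e)))
                                              (λ e → c≢0 (≡.cong toℕ (vec-injectiveⁱ {s} {plus} e)))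

  module Reflection (k : Fin (suc n)) where
    open LongRootVectors plus (Fin.suc k) minus (inject₁ k) (suc≢inject₁ k) public

    involutive : ∀ j → ρ k (ρ k j) ≡ j
    involutive = swap₂-involutive p q′ q p′ p≢q′ p≢q p≢p′ q′≢q q′≢p′ q≢p′

    fixes-v0 : ρ k v0 ≡ v0
    fixes-v0 = swap₂-other p q′ q p′ v0 (λ ()) (λ ()) (λ ()) (λ ())

    up : ∀ s c c′ → toℕ c ≡ toℕ k → toℕ c′ ≡ suc (toℕ k) → ρ k (vec s c) ≡ vec s c′
    up s c c′ c≡k c′≡1+k
      with Finₚ.toℕ-injective {i = c} {j = inject₁ k} (≡.trans c≡k (≡.sym (Finₚ.toℕ-inject₁ k)))
         | Finₚ.toℕ-injective {i = c′} {j = Fin.suc k} c′≡1+k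
    up plus  c c′ _ _ | ≡.refl | ≡.refl = swap₂-q′ p q′ q p′
    up minus c c′ _ _ | ≡.refl | ≡.refl = swap₂-q p q′ q p′ (≡.≢-sym q′≢q) q≢p′ (≡.≢-sym p≢q)

    down : ∀ s c c′ → toℕ c ≡ suc (toℕ k) → toℕ c′ ≡ toℕ k → ρ k (vec s c) ≡ vec s c′
    down s c c′ c≡1+k c′≡k
      with Finₚ.toℕ-injective {i = c′} {j = inject₁ k} (≡.trans c′≡k (≡.sym (Finₚ.toℕ-inject₁ k)))
         | Finₚ.toℕ-injective {i = c} {j = Fin.suc k} c≡1+k
    down plus  c c′ _ _ | ≡.refl | ≡.refl = swap₂-p p q′ q p′ p≢q′ p≢p′
    down minus c c′ _ _ | ≡.refl | ≡.refl = swap₂-p′ p q′ q p′ (≡.≢-sym q′≢p′)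

    fixes : ∀ s c → toℕ c ≢ toℕ k → toℕ c ≢ suc (toℕ k) → ρ k (vec s c) ≡ vec s c
    fixes s c c≢k c≢1+k = swap₂-other p q′ q p′ (vec s c)
      (λ e → c≢k (≡.trans (≡.cong toℕ (vec-injectiveⁱ {s} {plus} e)) (Finₚ.toℕ-inject₁ k)))
      (λ e → c≢1+k (≡.cong toℕ (vec-injectiveⁱ {s} {minus} e)))
      (λ e → c≢1+k (≡.cong toℕ (vec-injectiveⁱ {s} {plus} e)))
      (λ e → c≢k (≡.trans (≡.cong toℕ (vec-injectiveⁱ {s} {minus} e)) (Finₚ.toℕ-inject₁ k)))

  cycle : ∀ {m} → (Fin m → Fin (suc n)) → Idx → Idx
  cycle {zero}  φ j = j
  cycle {suc m} φ j = ρ (φ Fin.zero) (cycle (φ ∘ Fin.suc) j)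

  cycle⁻¹ : ∀ {m} → (Fin m → Fin (suc n)) → Idx → Idx
  cycle⁻¹ {zero}  φ j = j
  cycle⁻¹ {suc m} φ j = cycle⁻¹ (φ ∘ Fin.suc) (ρ (φ Fin.zero) j)

  cycle-cycle⁻¹ : ∀ {m} φ j → cycle {m} φ (cycle⁻¹ φ j) ≡ j
  cycle-cycle⁻¹ {zero}  φ j = ≡.refl
  cycle-cycle⁻¹ {suc m} φ j =
    ≡.trans (≡.cong (ρ (φ Fin.zero)) (cycle-cycle⁻¹ (φ ∘ Fin.suc) (ρ (φ Fin.zero) j))) (Reflection.involutive (φ Fin.zero) j)

  cycle⁻¹-cycle : ∀ {m} φ j → cycle⁻¹ {m} φ (cycle φ j) ≡ j
  cycle⁻¹-cycle {zero}  φ j = ≡.refl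
  cycle⁻¹-cycle {suc m} φ j =
    ≡.trans (≡.cong (cycle⁻¹ (φ ∘ Fin.suc)) (Reflection.involutive (φ Fin.zero) _)) (cycle⁻¹-cycle (φ ∘ Fin.suc) j)

  cycle-v0 : ∀ {m} φ → cycle {m} φ v0 ≡ v0
  cycle-v0 {zero}  φ = ≡.refl
  cycle-v0 {suc m} φ = ≡.trans (≡.cong (ρ (φ Fin.zero)) (cycle-v0 (φ ∘ Fin.suc))) (Reflection.fixes-v0 (φ Fin.zero))

  prod-nₖ≋perm-cycle : ∀ {m} (φ : Fin m → Fin (suc n)) →
                       prod (tabulate (λ k → nR (simpleRoot (Fin.suc (φ k))) 1#)) ≋ perm (cycle φ)
  prod-nₖ≋perm-cycle {zero}  φ = ≋-sym (monomial≋I (λ _ → ≡.refl) (λ _ → refl))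
  prod-nₖ≋perm-cycle {suc m} φ =
    ≋-trans (·-cong (nₖ≋perm (φ Fin.zero)) (prod-nₖ≋perm-cycle (φ ∘ Fin.suc))) (perm-· (ρ (φ Fin.zero)) (cycle (φ ∘ Fin.suc)))

  -- For consecutive φ, cycle φ = ρ a ∘ ρ (a + 1) ∘ ⋯ is the cycle e_a → e_(a+1) → ⋯ → e_(a+m) → e_a.
  Consecutive : ℕ → ∀ {m} → (Fin m → Fin (suc n)) → Set
  Consecutive a φ = ∀ k → toℕ (φ k) ≡ a ℕ.+ toℕ k

  module _ {m a} {φ : Fin (suc m) → Fin (suc n)} (φ-consecutive : Consecutive a φ) where
    head≡a : toℕ (φ Fin.zero) ≡ a
    head≡a = ≡.trans (φ-consecutive Fin.zero) (ℕₚ.+-identityʳ a)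

    tail-consecutive : Consecutive (suc a) (φ ∘ Fin.suc)
    tail-consecutive k = ≡.trans (φ-consecutive (Fin.suc k)) (ℕₚ.+-suc a (toℕ k))

  cycle-fixes : ∀ s {m} a (φ : Fin m → Fin (suc n)) → Consecutive a φ →
                ∀ c → toℕ c < a ⊎ a ℕ.+ m < toℕ c → cycle φ (vec s c) ≡ vec s c
  cycle-fixes s {zero}  a φ φ-cons c outside = ≡.refl
  cycle-fixes s {suc m} a φ φ-cons c outside =
    ≡.trans (≡.cong (ρ (φ Fin.zero)) (cycle-fixes s (suc a) (φ ∘ Fin.suc) (tail-consecutive φ-cons) c (shift outside)))
            (Reflection.fixes (φ Fin.zero) s c (c≢a outside) (c≢1+a outside))
    where
    shift : toℕ c < a ⊎ a ℕ.+ suc m < toℕ c → toℕ c < suc a ⊎ suc a ℕ.+ m < toℕ c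
    shift (inj₁ c<a)     = inj₁ (ℕₚ.m<n⇒m<1+n c<a)
    shift (inj₂ a+1+m<c) = inj₂ (≡.subst (_< toℕ c) (ℕₚ.+-suc a m) a+1+m<c)
    c≢a : toℕ c < a ⊎ a ℕ.+ suc m < toℕ c → toℕ c ≢ toℕ (φ Fin.zero)
    c≢a (inj₁ c<a)     e = ℕₚ.<-irrefl (≡.trans e (head≡a φ-cons)) c<a
    c≢a (inj₂ a+1+m<c) e = ℕₚ.<-irrefl (≡.sym (≡.trans e (head≡a φ-cons))) (ℕₚ.≤-<-trans (ℕₚ.m≤m+n a (suc m)) a+1+m<c)
    c≢1+a : toℕ c < a ⊎ a ℕ.+ suc m < toℕ c → toℕ c ≢ suc (toℕ (φ Fin.zero))
    c≢1+a (inj₁ c<a) e = ℕₚ.<-asym c<a (≡.subst (a <_) (≡.sym (≡.trans e (≡.cong suc (head≡a φ-cons)))) (ℕₚ.n<1+n a))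
    c≢1+a (inj₂ a+1+m<c) e =
      ℕₚ.<-irrefl (≡.sym (≡.trans e (≡.cong suc (head≡a φ-cons))))
                  (ℕₚ.≤-<-trans (≡.subst (suc a ≤_) (≡.sym (ℕₚ.+-suc a m)) (s≤s (ℕₚ.m≤m+n a m))) a+1+m<c)

  cycle-shifts : ∀ s {m} a (φ : Fin m → Fin (suc n)) → Consecutive a φ →
                 ∀ c c′ → a ≤ toℕ c → toℕ c < a ℕ.+ m → toℕ c′ ≡ suc (toℕ c) → cycle φ (vec s c) ≡ vec s c′
  cycle-shifts s {zero} a φ φ-cons c c′ a≤c c<a+0 _ =
    ⊥-elim (ℕₚ.<-irrefl ≡.refl (ℕₚ.≤-<-trans a≤c (≡.subst (toℕ c <_) (ℕₚ.+-identityʳ a) c<a+0)))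
  cycle-shifts s {suc m} a φ φ-cons c c′ a≤c c<a+1+m c′≡1+c with toℕ c ℕ.≟ a
  ... | yes c≡a =
    ≡.trans (≡.cong (ρ (φ Fin.zero)) (cycle-fixes s (suc a) (φ ∘ Fin.suc) (tail-consecutive φ-cons) c
                                                   (inj₁ (≡.subst (_< suc a) (≡.sym c≡a) (ℕₚ.n<1+n a)))))
            (Reflection.up (φ Fin.zero) s c c′ c≡φ0 (≡.trans c′≡1+c (≡.cong suc c≡φ0)))
    where c≡φ0 = ≡.trans c≡a (≡.sym (head≡a φ-cons))
  ... | no c≢a =
    ≡.trans (≡.cong (ρ (φ Fin.zero)) (cycle-shifts s (suc a) (φ ∘ Fin.suc) (tail-consecutive φ-cons) c c′
                                                   (ℕₚ.≤∧≢⇒< a≤c (≡.≢-sym c≢a)) (≡.subst (toℕ c <_) (ℕₚ.+-suc a m) c<a+1+m) c′≡1+c))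
            (Reflection.fixes (φ Fin.zero) s c′
              (λ e → ℕₚ.<-irrefl (≡.sym (≡.trans e (head≡a φ-cons))) (ℕₚ.≤-<-trans a≤c (≡.subst (toℕ c <_) (≡.sym c′≡1+c) (ℕₚ.n<1+n (toℕ c)))))
              (λ e → c≢a (ℕₚ.suc-injective (≡.trans (≡.sym c′≡1+c) (≡.trans e (≡.cong suc (head≡a φ-cons)))))))

  cycle-wraps : ∀ s {m} a (φ : Fin m → Fin (suc n)) → Consecutive a φ →
                ∀ c c′ → toℕ c ≡ a ℕ.+ m → toℕ c′ ≡ a → cycle φ (vec s c) ≡ vec s c′
  cycle-wraps s {zero} a φ φ-cons c c′ c≡a+0 c′≡a =
    ≡.cong (vec s) (Finₚ.toℕ-injective (≡.trans c≡a+0 (≡.trans (ℕₚ.+-identityʳ a) (≡.sym c′≡a))))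
  cycle-wraps s {suc m} a φ φ-cons c c′ c≡a+1+m c′≡a =
    ≡.trans (≡.cong (ρ (φ Fin.zero)) (cycle-wraps s (suc a) (φ ∘ Fin.suc) (tail-consecutive φ-cons) c c″
                                                  (≡.trans c≡a+1+m (ℕₚ.+-suc a m)) c″≡1+a))
            (Reflection.down (φ Fin.zero) s c″ c′ (≡.trans c″≡1+a (≡.cong suc (≡.sym (head≡a φ-cons))))
                                                   (≡.trans c′≡a (≡.sym (head≡a φ-cons))))
    where
    1+a<l : suc a < l
    1+a<l = ℕₚ.≤-<-trans (≡.subst (suc a ≤_) (≡.sym (≡.trans c≡a+1+m (ℕₚ.+-suc a m))) (s≤s (ℕₚ.m≤m+n a m))) (Finₚ.toℕ<n c)
    c″ : Fin l
    c″ = Fin.fromℕ< 1+a<l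
    c″≡1+a : toℕ c″ ≡ suc a
    c″≡1+a = Finₚ.toℕ-fromℕ< 1+a<l

  -- σw, the permutation of w = w_1 ⋯ w_l, is the signed cycle e_0 → e_1 → ⋯ → e_(l-1) → -e_0 (0-based).
  σw : Idx → Idx
  σw j = ρ₀ (cycle (λ k → k) j)

  τw : Idx → Idx
  τw j = cycle⁻¹ (λ k → k) (ρ₀ j)

  σw-τw : ∀ j → σw (τw j) ≡ j
  σw-τw j = ≡.trans (≡.cong ρ₀ (cycle-cycle⁻¹ (λ k → k) (ρ₀ j))) (ρ₀-involutive j)

  τw-σw : ∀ j → τw (σw j) ≡ j
  τw-σw j = ≡.trans (≡.cong (cycle⁻¹ (λ k → k)) (ρ₀-involutive (cycle (λ k → k) j))) (cycle⁻¹-cycle (λ k → k) j)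

  σw-injective : Injective {A = Idx} _≡_ _≡_ σw
  σw-injective {a} {b} σwa≡σwb = ≡.trans (≡.sym (τw-σw a)) (≡.trans (≡.cong τw σwa≡σwb) (τw-σw b))

  σw-v0 : σw v0 ≡ v0
  σw-v0 = ≡.trans (≡.cong ρ₀ (cycle-v0 (λ k → k))) ρ₀-v0

  σw-shifts : ∀ s c c′ → toℕ c < suc n → toℕ c′ ≡ suc (toℕ c) → σw (vec s c) ≡ vec s c′
  σw-shifts s c c′ c<1+n c′≡1+c =
    ≡.trans (≡.cong ρ₀ (cycle-shifts s 0 (λ k → k) (λ k → ≡.refl) c c′ z≤n c<1+n c′≡1+c))
            (ρ₀-other s c′ (λ c′≡0 → ℕₚ.0≢1+n (≡.trans (≡.sym c′≡0) c′≡1+c)))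

  σw-wraps : ∀ s c → toℕ c ≡ suc n → σw (vec s c) ≡ vec (flipS s) Fin.zero
  σw-wraps s c c≡1+n = ≡.trans (≡.cong ρ₀ (cycle-wraps s 0 (λ k → k) (λ k → ≡.refl) c Fin.zero c≡1+n ≡.refl)) (ρ₀-e₀ s)

  σw^-shifts : ∀ s m c c′ → toℕ c′ ≡ toℕ c ℕ.+ m → (σw ^ᶠ m) (vec s c) ≡ vec s c′
  σw^-shifts s zero c c′ c′≡c+0 = ≡.cong (vec s) (Finₚ.toℕ-injective (≡.sym (≡.trans c′≡c+0 (ℕₚ.+-identityʳ _))))
  σw^-shifts s (suc m) c c′ c′≡c+1+m =
    ≡.trans (≡.cong σw (σw^-shifts s m c c″ c″≡c+m)) (σw-shifts s c″ c′ c″<1+n (≡.trans c′≡1+c+m (≡.cong suc (≡.sym c″≡c+m))))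
    where
    c′≡1+c+m : toℕ c′ ≡ suc (toℕ c ℕ.+ m)
    c′≡1+c+m = ≡.trans c′≡c+1+m (ℕₚ.+-suc (toℕ c) m)
    c+m<1+n : toℕ c ℕ.+ m < suc n
    c+m<1+n = ℕₚ.≤-pred (≡.subst (_< l) c′≡1+c+m (Finₚ.toℕ<n c′))
    c″ : Fin l
    c″ = Fin.fromℕ< (ℕₚ.<-trans c+m<1+n (ℕₚ.n<1+n (suc n)))
    c″≡c+m : toℕ c″ ≡ toℕ c ℕ.+ m
    c″≡c+m = Finₚ.toℕ-fromℕ< _
    c″<1+n : toℕ c″ < suc n
    c″<1+n = ≡.subst (_< suc n) (≡.sym c″≡c+m) c+m<1+n

  nProd≋perm-σw : nProd ≋ perm σw
  nProd≋perm-σw =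
    ≡.subst (_≋ perm σw) (≡.sym (≡.cong prod (Listₚ.map-tabulate (λ k → k) (λ i → nR (simpleRoot i) 1#))))
            (≋-trans (·-cong n₀≋perm (prod-nₖ≋perm-cycle (λ k → k))) (perm-· ρ₀ (cycle (λ k → k))))

  -- R is the last positive basis vector: the R-row of n_w^j detects j, while K_b fixes the R-row.
  R : Idx
  R = vec plus (Fin.fromℕ (suc n))

  module WeylRepresentative (h : Mat) (h∈H : InH h) where
    d : Idx → Carrier
    d = proj₁ (InH-toral h h∈H)

    d-paired : Paired d
    d-paired = proj₁ (proj₂ (InH-toral h h∈H))

    nw : Mat
    nw = nProd · h

    nw≋monomial : nw ≋ monomial σw d
    nw≋monomial = ≋-trans (·-cong nProd≋perm-σw (proj₂ (proj₂ (InH-toral h h∈H))))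
                          (≋-trans (monomial-· σw _ (λ j → j) d) (monomial-cong (λ _ → ≡.refl) (λ j → *-identityˡ (d j))))

    nw⁻¹ : Mat
    nw⁻¹ = monomial τw (λ j → d (flipV (τw j)))

    nw·nw⁻¹≋I : nw · nw⁻¹ ≋ I
    nw·nw⁻¹≋I = ≋-trans (·-congʳ {B = nw⁻¹} nw≋monomial)
                        (≋-trans (monomial-· σw d τw (λ j → d (flipV (τw j)))) (monomial≋I σw-τw (λ j → at-flip d-paired (τw j))))

    nw⁻¹·nw≋I : nw⁻¹ · nw ≋ I
    nw⁻¹·nw≋I = ≋-trans (·-congˡ {nw⁻¹} nw≋monomial)
                        (≋-trans (monomial-· τw (λ j → d (flipV (τw j))) σw d)
                                 (monomial≋I τw-σw (λ j → trans (*-congʳ (reflexive (≡.cong (λ z → d (flipV z)) (τw-σw j))))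
                                                                (trans (*-comm _ _) (at-flip d-paired j)))))

    nw^≋monomial : ∀ m → nw ^ m ≋ monomial (σw ^ᶠ m) (coeff^ m σw d)
    nw^≋monomial m = ≋-trans (^-cong m nw≋monomial) (monomial-^ σw d m)

    nw^-R-entry-zero : ∀ m c → toℕ c ℕ.+ m < suc n → (nw ^ m) R (vec plus c) ≈ 0#
    nw^-R-entry-zero m c c+m<1+n =
      trans (get (nw^≋monomial m) R (vec plus c))
            (trans (*-congʳ (trans (reflexive (≡.cong (δ R) (σw^-shifts plus m c c′ c′≡c+m))) (δ-≢ R≢c′))) (zeroˡ _))
      where
      c′ : Fin l
      c′ = Fin.fromℕ< (ℕₚ.<-trans c+m<1+n (ℕₚ.n<1+n (suc n)))
      c′≡c+m : toℕ c′ ≡ toℕ c ℕ.+ m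
      c′≡c+m = Finₚ.toℕ-fromℕ< _
      R≢c′ : R ≢ vec plus c′
      R≢c′ e = ℕₚ.<-irrefl (≡.trans (≡.sym c′≡c+m) (≡.trans (≡.cong toℕ (≡.sym (vec-injectiveⁱ {plus} {plus} e))) (Finₚ.toℕ-fromℕ (suc n))))
                           c+m<1+n

    nw^-R-entry-unit : ∀ m c → toℕ c ℕ.+ m ≡ suc n → ¬ (nw ^ m) R (vec plus c) ≈ 0#
    nw^-R-entry-unit m c c+m≡1+n entry≈0 =
      Unit⇒≉0 (coeff^-unit σw d (λ x → d (flipV x) , at-flip d-paired x) m (vec plus c))
              (trans (sym (trans (*-congʳ (trans (reflexive (≡.cong (δ R) (σw^-shifts plus m c _ last≡c+m))) (δ-refl R)))
                                 (*-identityˡ _)))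
                     (trans (sym (get (nw^≋monomial m) R (vec plus c))) entry≈0))
      where
      last≡c+m : toℕ (Fin.fromℕ (suc n)) ≡ toℕ c ℕ.+ m
      last≡c+m = ≡.trans (Finₚ.toℕ-fromℕ (suc n)) (≡.sym c+m≡1+n)

    nw^-R-rows-differ : ∀ j j′ → j < j′ → j′ ≤ n → Σ Idx λ c → (nw ^ j) R c ≈ 0# × ¬ (nw ^ j′) R c ≈ 0#
    nw^-R-rows-differ j j′ j<j′ j′≤n =
      vec plus c , nw^-R-entry-zero j c (≡.subst (λ t → t ℕ.+ j < suc n) (≡.sym c≡t) t+j<1+n)
                 , nw^-R-entry-unit j′ c (≡.trans (≡.cong (ℕ._+ j′) c≡t) t+j′≡1+n)
      where
      t : ℕ
      t = suc n ℕ.∸ j′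
      t+j′≡1+n : t ℕ.+ j′ ≡ suc n
      t+j′≡1+n = ℕₚ.m∸n+n≡m (ℕₚ.m≤n⇒m≤1+n j′≤n)
      t+j<1+n : t ℕ.+ j < suc n
      t+j<1+n = ≡.subst (t ℕ.+ j <_) t+j′≡1+n (ℕₚ.+-monoʳ-< t j<j′)
      c : Fin l
      c = Fin.fromℕ< (ℕₚ.≤-<-trans (ℕₚ.m∸n≤m (suc n) j′) (ℕₚ.n<1+n (suc n)))
      c≡t : toℕ c ≡ t
      c≡t = Finₚ.toℕ-fromℕ< _

module KbMembership (F : FiniteField2) (n : ℕ) where
  open CoxeterElement F n public

  InKb-x : ∀ i → toℕ i < suc n → ∀ u → InKb (x (simpleRoot i) u)
  InKb-x i i<1+n u = Gen-gen (i , i<1+n , plus , u , ≡.refl)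

  InKb-x⁻ : ∀ i → toℕ i < suc n → ∀ u → InKb (x (negR (simpleRoot i)) u)
  InKb-x⁻ i i<1+n u = Gen-gen (i , i<1+n , minus , u , ≡.refl)

  InKb-n : ∀ i → toℕ i < suc n → InKb (nR (simpleRoot i) 1#)
  InKb-n i i<1+n = Gen-· (InKb-x i i<1+n 1#) (Gen-· (InKb-x⁻ i i<1+n _) (InKb-x i i<1+n 1#))

  InKb-conj : ∀ {M X A} → InKb M → M · M ≋ I → InKb X → M · X ≋ A · M → InKb A
  InKb-conj {M} {X} {A} M∈Kb MM≋I X∈Kb MX≋AM = Gen-cong MXM≋A (Gen-· (Gen-· M∈Kb X∈Kb) M∈Kb)
    where
    open ≋-Reasoning
    MXM≋A : (M · X) · M ≋ A
    MXM≋A = begin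
      (M · X) · M ≈⟨ ·-congʳ {B = M} MX≋AM ⟩
      (A · M) · M ≈⟨ ·-assoc A M M ⟩
      A · (M · M) ≈⟨ ·-congˡ {A} MM≋I ⟩
      A · I       ≈⟨ ·-identityʳ A ⟩
      A           ∎

  ρ₀-injective : Injective {A = Idx} _≡_ _≡_ ρ₀
  ρ₀-injective = involutive⇒injective ρ₀ ρ₀-involutive

  ρ-injective : ∀ k → Injective {A = Idx} _≡_ _≡_ (ρ k)
  ρ-injective k = involutive⇒injective (ρ k) (Reflection.involutive k)

  InKb-conjₖ-XS : ∀ k {p q p′ q′} → ρ k p ≡ p′ → ρ k q ≡ q′ → toℕ (Fin.suc k) < suc n →
                  ∀ u → InKb (XS p q u) → InKb (XS p′ q′ u)
  InKb-conjₖ-XS k {p} {q} {p′} {q′} ρp ρq 1+k<1+n u X∈Kb =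
    InKb-conj (InKb-n (Fin.suc k) 1+k<1+n) (nR-involutive (simpleRoot (Fin.suc k)) 1#) X∈Kb
      (≋-trans (·-congʳ {B = XS p q u} (nₖ≋perm k))
               (≋-trans (perm-conj-XS (ρ k) p q p′ q′ u (ρ-injective k) (Reflection.fixes-v0 k) ρp ρq)
                        (·-congˡ {XS p′ q′ u} (≋-sym (nₖ≋perm k)))))

  InKb-conjₖ-XL : ∀ k {p q′ q p′ P Q′ Q P′} → ρ k p ≡ P → ρ k q′ ≡ Q′ → ρ k q ≡ Q → ρ k p′ ≡ P′ → toℕ (Fin.suc k) < suc n →
                  ∀ u → InKb (XL p q′ q p′ u) → InKb (XL P Q′ Q P′ u)
  InKb-conjₖ-XL k {p} {q′} {q} {p′} {P} {Q′} {Q} {P′} ρp ρq′ ρq ρp′ 1+k<1+n u X∈Kb =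
    InKb-conj (InKb-n (Fin.suc k) 1+k<1+n) (nR-involutive (simpleRoot (Fin.suc k)) 1#) X∈Kb
      (≋-trans (·-congʳ {B = XL p q′ q p′ u} (nₖ≋perm k))
               (≋-trans (perm-conj-XL (ρ k) p q′ q p′ P Q′ Q P′ u (ρ-injective k) ρp ρq′ ρq ρp′)
                        (·-congˡ {XL P Q′ Q P′ u} (≋-sym (nₖ≋perm k)))))

  InKb-conj₀-XL : ∀ {p q′ q p′ P Q′ Q P′} → ρ₀ p ≡ P → ρ₀ q′ ≡ Q′ → ρ₀ q ≡ Q → ρ₀ p′ ≡ P′ →
                  ∀ u → InKb (XL p q′ q p′ u) → InKb (XL P Q′ Q P′ u)
  InKb-conj₀-XL {p} {q′} {q} {p′} {P} {Q′} {Q} {P′} ρp ρq′ ρq ρp′ u X∈Kb =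
    InKb-conj (InKb-n Fin.zero (s≤s z≤n)) (nR-involutive (simpleRoot Fin.zero) 1#) X∈Kb
      (≋-trans (·-congʳ {B = XL p q′ q p′ u} n₀≋perm)
               (≋-trans (perm-conj-XL ρ₀ p q′ q p′ P Q′ Q P′ u ρ₀-injective ρp ρq′ ρq ρp′)
                        (·-congˡ {XL P Q′ Q P′ u} (≋-sym n₀≋perm))))

  toℕ≢0⇒suc : (c : Fin l) → toℕ c ≢ 0 → Σ (Fin (suc n)) λ k → c ≡ Fin.suc k
  toℕ≢0⇒suc Fin.zero    c≢0 = ⊥-elim (c≢0 ≡.refl)
  toℕ≢0⇒suc (Fin.suc k) _   = k , ≡.refl

  toℕ≡⇒inject₁ : ∀ (c : Fin l) (k : Fin (suc n)) → toℕ c ≡ toℕ k → c ≡ inject₁ k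
  toℕ≡⇒inject₁ c k c≡k = Finₚ.toℕ-injective (≡.trans c≡k (≡.sym (Finₚ.toℕ-inject₁ k)))

  -- x_{-e_c}(u), by conjugating x_{-e_0}(u) = x_{-r_1}(u) with n_{r_2}, …, n_{r_(c+1)}.
  InKb-x₋ₑ : ∀ t (c : Fin l) → toℕ c ≡ t → t < suc n → ∀ u → InKb (XS (vec minus c) (vec plus c) u)
  InKb-x₋ₑ zero c c≡0 _ u with Finₚ.toℕ-injective {i = c} {j = Fin.zero} c≡0
  ... | ≡.refl = InKb-x⁻ Fin.zero (s≤s z≤n) u
  InKb-x₋ₑ (suc t) c c≡1+t 1+t<1+n u with toℕ≢0⇒suc c (λ c≡0 → ℕₚ.0≢1+n (≡.trans (≡.sym c≡0) c≡1+t))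
  ... | k , ≡.refl =
    InKb-conjₖ-XS k (Reflection.up k minus (inject₁ k) (Fin.suc k) (Finₚ.toℕ-inject₁ k) ≡.refl)
                    (Reflection.up k plus (inject₁ k) (Fin.suc k) (Finₚ.toℕ-inject₁ k) ≡.refl)
                    (≡.subst (_< suc n) (≡.sym c≡1+t) 1+t<1+n) u
                    (InKb-x₋ₑ t (inject₁ k) (≡.trans (Finₚ.toℕ-inject₁ k) (ℕₚ.suc-injective c≡1+t)) (ℕₚ.<-trans (ℕₚ.n<1+n t) 1+t<1+n) u)

  -- x_{-e_c - e_{c+1}}(u), from x_{e_0 - e_1}(u) = x_{-r_2}(u) by conjugating with n_{r_1} and then
  -- moving both indices up with the n_{r_k}.
  InKb-x₋ₑ₋ₑ : ∀ t (c c′ : Fin l) → toℕ c ≡ t → toℕ c′ ≡ suc t → suc t < suc n →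
               ∀ u → InKb (XL (vec minus c) (vec plus c′) (vec minus c′) (vec plus c) u)
  InKb-x₋ₑ₋ₑ zero c c′ c≡0 c′≡1 1<1+n u
    with Finₚ.toℕ-injective {i = c} {j = Fin.zero} c≡0 | toℕ≢0⇒suc c′ (λ c′≡0 → ℕₚ.0≢1+n (≡.trans (≡.sym c′≡0) c′≡1))
  ... | ≡.refl | k , ≡.refl = Gen-cong (XL-swap _ _ _ _ u) conjugated
    where
    k≡0 : inject₁ k ≡ Fin.zero
    k≡0 = Finₚ.toℕ-injective (≡.trans (Finₚ.toℕ-inject₁ k) (ℕₚ.suc-injective c′≡1))
    conjugated : InKb (XL (vec minus (Fin.suc k)) (vec plus Fin.zero) (vec minus Fin.zero) (vec plus (Fin.suc k)) u)
    conjugated =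
      InKb-conj₀-XL (ρ₀-other minus (Fin.suc k) (λ ())) (≡.trans (≡.cong (λ z → ρ₀ (vec minus z)) k≡0) (ρ₀-e₀ minus))
                    (≡.trans (≡.cong (λ z → ρ₀ (vec plus z)) k≡0) (ρ₀-e₀ plus)) (ρ₀-other plus (Fin.suc k) (λ ())) u
                    (InKb-x⁻ (Fin.suc k) (≡.subst (_< suc n) (≡.sym c′≡1) 1<1+n) u)
  InKb-x₋ₑ₋ₑ (suc t) c c′ c≡1+t c′≡2+t 2+t<1+n u
    with toℕ≢0⇒suc c′ (λ c′≡0 → ℕₚ.0≢1+n (≡.trans (≡.sym c′≡0) c′≡2+t)) | toℕ≢0⇒suc c (λ c≡0 → ℕₚ.0≢1+n (≡.trans (≡.sym c≡0) c≡1+t))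
  ... | k , ≡.refl | k′ , ≡.refl = moved-down
    where
    t<l : t < l
    t<l = ℕₚ.<-trans (ℕₚ.n<1+n t) (≡.subst (_< l) c≡1+t (Finₚ.toℕ<n c))
    c₀ : Fin l
    c₀ = Fin.fromℕ< t<l
    c₀≡t : toℕ c₀ ≡ t
    c₀≡t = Finₚ.toℕ-fromℕ< t<l
    k≡1+t : toℕ k ≡ suc t
    k≡1+t = ℕₚ.suc-injective c′≡2+t
    k′≡t : toℕ k′ ≡ t
    k′≡t = ℕₚ.suc-injective c≡1+t
    c₀≢k : toℕ c₀ ≢ toℕ k
    c₀≢k e = ℕₚ.1+n≢n (≡.sym (≡.trans (≡.sym c₀≡t) (≡.trans e k≡1+t)))
    c₀≢1+k : toℕ c₀ ≢ suc (toℕ k)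
    c₀≢1+k e = ℕₚ.<-irrefl (≡.trans (≡.sym c₀≡t) (≡.trans e (≡.cong suc k≡1+t))) (ℕₚ.<-trans (ℕₚ.n<1+n t) (ℕₚ.n<1+n (suc t)))
    c′≢k′ : toℕ c′ ≢ toℕ k′
    c′≢k′ e = ℕₚ.<-irrefl (≡.sym (≡.trans (≡.sym c′≡2+t) (≡.trans e k′≡t))) (ℕₚ.<-trans (ℕₚ.n<1+n t) (ℕₚ.n<1+n (suc t)))
    c′≢1+k′ : toℕ c′ ≢ suc (toℕ k′)
    c′≢1+k′ e = ℕₚ.1+n≢n (≡.trans (≡.sym c′≡2+t) (≡.trans e (≡.cong suc k′≡t)))
    previous : InKb (XL (vec minus c₀) (vec plus c) (vec minus c) (vec plus c₀) u)
    previous = InKb-x₋ₑ₋ₑ t c₀ c c₀≡t c≡1+t (ℕₚ.<-trans (ℕₚ.n<1+n _) 2+t<1+n) u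
    moved-up : InKb (XL (vec minus c₀) (vec plus c′) (vec minus c′) (vec plus c₀) u)
    moved-up = InKb-conjₖ-XL k (Reflection.fixes k minus c₀ c₀≢k c₀≢1+k) (Reflection.up k plus c c′ (≡.trans c≡1+t (≡.sym k≡1+t)) ≡.refl)
                               (Reflection.up k minus c c′ (≡.trans c≡1+t (≡.sym k≡1+t)) ≡.refl) (Reflection.fixes k plus c₀ c₀≢k c₀≢1+k)
                               (≡.subst (_< suc n) (≡.sym c′≡2+t) 2+t<1+n) u previous
    moved-down : InKb (XL (vec minus c) (vec plus c′) (vec minus c′) (vec plus c) u)
    moved-down = InKb-conjₖ-XL k′ (Reflection.up k′ minus c₀ c (≡.trans c₀≡t (≡.sym k′≡t)) ≡.refl) (Reflection.fixes k′ plus c′ c′≢k′ c′≢1+k′)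
                                  (Reflection.fixes k′ minus c′ c′≢k′ c′≢1+k′) (Reflection.up k′ plus c₀ c (≡.trans c₀≡t (≡.sym k′≡t)) ≡.refl)
                                  (≡.subst (_< suc n) (≡.sym c≡1+t) (ℕₚ.<-trans (ℕₚ.n<1+n (suc t)) 2+t<1+n)) u moved-up

  InKb-x₋ₑ₊ₑ : ∀ (c c′ : Fin l) → toℕ c′ ≡ suc (toℕ c) → toℕ c′ < suc n →
               ∀ u → InKb (XL (vec minus c) (vec minus c′) (vec plus c′) (vec plus c) u)
  InKb-x₋ₑ₊ₑ c c′ c′≡1+c c′<1+n u with toℕ≢0⇒suc c′ (λ c′≡0 → ℕₚ.0≢1+n (≡.trans (≡.sym c′≡0) c′≡1+c))
  ... | k , ≡.refl with toℕ≡⇒inject₁ c k (≡.sym (ℕₚ.suc-injective c′≡1+c))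
  ... | ≡.refl = Gen-cong (XL-swap _ _ _ _ u) (InKb-x (Fin.suc k) c′<1+n u)

  InKb-x₊ₑ₋ₑ : ∀ (c c′ : Fin l) → toℕ c′ ≡ suc (toℕ c) → toℕ c′ < suc n →
               ∀ u → InKb (XL (vec plus c) (vec plus c′) (vec minus c′) (vec minus c) u)
  InKb-x₊ₑ₋ₑ c c′ c′≡1+c c′<1+n u with toℕ≢0⇒suc c′ (λ c′≡0 → ℕₚ.0≢1+n (≡.trans (≡.sym c′≡0) c′≡1+c))
  ... | k , ≡.refl with toℕ≡⇒inject₁ c k (≡.sym (ℕₚ.suc-injective c′≡1+c))
  ... | ≡.refl = Gen-cong (XL-swap _ _ _ _ u) (InKb-x⁻ (Fin.suc k) c′<1+n u)

module Conjugation (F : FiniteField2) (n : ℕ) where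
  open KbMembership F n public

  -- fin k has value k when k < l; the junk value 0 for k ≥ l is never used.
  fin : ℕ → Fin l
  fin k with k ℕ.<? l
  ... | yes k<l = Fin.fromℕ< k<l
  ... | no _    = Fin.zero

  toℕ-fin : ∀ k → k < l → toℕ (fin k) ≡ k
  toℕ-fin k k<l with k ℕ.<? l
  ... | yes _   = Finₚ.toℕ-fromℕ< _
  ... | no k≮l = ⊥-elim (k≮l k<l)

  fin-0 : fin 0 ≡ Fin.zero
  fin-0 = Finₚ.toℕ-injective (toℕ-fin 0 (s≤s z≤n))

  toℕ-fin-suc : ∀ k → k < suc n → toℕ (fin (suc k)) ≡ suc (toℕ (fin k))
  toℕ-fin-suc k k<1+n = ≡.trans (toℕ-fin (suc k) (s≤s k<1+n)) (≡.cong suc (≡.sym (toℕ-fin k (ℕₚ.<-trans k<1+n (ℕₚ.n<1+n _)))))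

  toℕ-fin< : ∀ k → k < suc n → toℕ (fin k) < suc n
  toℕ-fin< k k<1+n = ≡.subst (_< suc n) (≡.sym (toℕ-fin k (ℕₚ.<-trans k<1+n (ℕₚ.n<1+n _)))) k<1+n

  σw-fin : ∀ s k → k < suc n → σw (vec s (fin k)) ≡ vec s (fin (suc k))
  σw-fin s k k<1+n = σw-shifts s (fin k) (fin (suc k)) (toℕ-fin< k k<1+n) (toℕ-fin-suc k k<1+n)

  σw-e₀ : ∀ s → σw (vec s Fin.zero) ≡ vec s (fin 1)
  σw-e₀ s = ≡.subst (λ z → σw (vec s z) ≡ vec s (fin 1)) fin-0 (σw-fin s 0 (s≤s z≤n))

  σw-eₗ : ∀ s → σw (vec s (Fin.fromℕ (suc n))) ≡ vec (flipS s) Fin.zero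
  σw-eₗ s = σw-wraps s (Fin.fromℕ (suc n)) (Finₚ.toℕ-fromℕ (suc n))

  hₜ hₜ⁻¹ : Carrier → Mat
  hₜ u   = hR (tRoot n) u
  hₜ⁻¹ u = nR (tRoot n) (- 1#) · nR (tRoot n) u

  hₜ·hₜ⁻¹≋I : ∀ u → hₜ u · hₜ⁻¹ u ≋ I
  hₜ·hₜ⁻¹≋I u = involution-product-inverse (nR (tRoot n) u) (nR (tRoot n) (- 1#)) (nR-involutive (tRoot n) u) (nR-involutive (tRoot n) (- 1#))

  hₜ⁻¹·hₜ≋I : ∀ u → hₜ⁻¹ u · hₜ u ≋ I
  hₜ⁻¹·hₜ≋I u = involution-product-inverse (nR (tRoot n) (- 1#)) (nR (tRoot n) u) (nR-involutive (tRoot n) (- 1#)) (nR-involutive (tRoot n) u)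

  module NwConjugation (h : Mat) (h∈H : InH h) where
    open WeylRepresentative h h∈H public

    nw-conj-XS : ∀ p q p′ q′ u → σw p ≡ p′ → σw q ≡ q′ → flipV p ≡ q → nw · XS p q u ≋ XS p′ q′ (u * d p) · nw
    nw-conj-XS p q p′ q′ u σp σq flip-p =
      ≋-trans (·-congʳ {B = XS p q u} nw≋monomial)
              (≋-trans (monomial-conj-XS σw d p q p′ q′ u σw-injective σw-v0 σp σq (at-v0 d-paired) (paired-at flip-p))
                       (·-congˡ {XS p′ q′ (u * d p)} (≋-sym nw≋monomial)))
      where
      paired-at : ∀ {a b} → flipV a ≡ b → d a * d b ≈ 1#
      paired-at {a} flip-a = trans (*-congˡ (reflexive (≡.cong d (≡.sym flip-a)))) (at-flip d-paired a)

    nw-conj-XL : ∀ p q′ q p′ P Q′ Q P′ u → σw p ≡ P → σw q′ ≡ Q′ → σw q ≡ Q → σw p′ ≡ P′ → flipV p ≡ p′ → flipV q ≡ q′ →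
                 nw · XL p q′ q p′ u ≋ XL P Q′ Q P′ (u * d p * d q) · nw
    nw-conj-XL p q′ q p′ P Q′ Q P′ u σp σq′ σq σp′ flip-p flip-q =
      ≋-trans (·-congʳ {B = XL p q′ q p′ u} nw≋monomial)
              (≋-trans (monomial-conj-XL σw d p q′ q p′ P Q′ Q P′ u σw-injective σp σq′ σq σp′ (paired-at flip-p) (paired-at flip-q))
                       (·-congˡ {XL P Q′ Q P′ (u * d p * d q)} (≋-sym nw≋monomial)))
      where
      paired-at : ∀ {a b} → flipV a ≡ b → d a * d b ≈ 1#
      paired-at {a} flip-a = trans (*-congˡ (reflexive (≡.cong d (≡.sym flip-a)))) (at-flip d-paired a)

    Orbit : (ℕ → Carrier → Mat) → ℕ → Set
    Orbit G m = ∀ k → k < m → ∀ u → Σ Carrier λ u′ → nw · G k u ≋ G (suc k) u′ · nw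

    orbit-conj : ∀ G m → Orbit G m → ∀ i → i ≤ m → ∀ u → Σ Carrier λ u′ → (nw ^ i) · G 0 u ≋ G i u′ · (nw ^ i)
    orbit-conj G m orbit zero _ u = u , ≋-trans (·-identityˡ (G 0 u)) (≋-sym (·-identityʳ (G 0 u)))
    orbit-conj G m orbit (suc i) 1+i≤m u = u″ , (begin
      (nw · (nw ^ i)) · G 0 u   ≈⟨ ·-assoc nw (nw ^ i) (G 0 u) ⟩
      nw · ((nw ^ i) · G 0 u)   ≈⟨ ·-congˡ {nw} conj-i ⟩
      nw · (G i u′ · (nw ^ i))  ≈⟨ ≋-sym (·-assoc nw (G i u′) (nw ^ i)) ⟩
      (nw · G i u′) · (nw ^ i)  ≈⟨ ·-congʳ {B = nw ^ i} step ⟩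
      (G (suc i) u″ · nw) · (nw ^ i) ≈⟨ ·-assoc (G (suc i) u″) nw (nw ^ i) ⟩
      G (suc i) u″ · (nw · (nw ^ i)) ∎)
      where
      open ≋-Reasoning
      u′ u″ : Carrier
      u′ = proj₁ (orbit-conj G m orbit i (ℕₚ.<⇒≤ 1+i≤m) u)
      u″ = proj₁ (orbit i 1+i≤m u′)
      conj-i : (nw ^ i) · G 0 u ≋ G i u′ · (nw ^ i)
      conj-i = proj₂ (orbit-conj G m orbit i (ℕₚ.<⇒≤ 1+i≤m) u)
      step : nw · G i u′ ≋ G (suc i) u″ · nw
      step = proj₂ (orbit i 1+i≤m u′)

    e₊ e₋ : ℕ → Idx
    e₊ k = vec plus (fin k)
    e₋ k = vec minus (fin k)

    e₀₊ e₀₋ eₗ₊ eₗ₋ : Idx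
    e₀₊ = vec plus Fin.zero
    e₀₋ = vec minus Fin.zero
    eₗ₊ = vec plus (Fin.fromℕ (suc n))
    eₗ₋ = vec minus (Fin.fromℕ (suc n))

    _◂_ : (Carrier → Mat) → (ℕ → Carrier → Mat) → ℕ → Carrier → Mat
    (X ◂ G) zero    = X
    (X ◂ G) (suc k) = G k

    x₋ₑ-orbit : ℕ → Carrier → Mat
    x₋ₑ-orbit k = XS (e₋ k) (e₊ k)

    x₋ₑ₋ₑ-orbit x₋ₑ₊ₑ-orbit x₊ₑ₋ₑ-orbit : ℕ → Carrier → Mat
    x₋ₑ₋ₑ-orbit k = XL (e₋ k) (e₊ (suc k)) (e₋ (suc k)) (e₊ k)
    x₋ₑ₊ₑ-orbit k = XL (e₋ k) (e₋ (suc k)) (e₊ (suc k)) (e₊ k)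
    x₊ₑ₋ₑ-orbit k = XL (e₊ k) (e₊ (suc k)) (e₋ (suc k)) (e₋ k)

    x₋ₑ-is-orbit : Orbit x₋ₑ-orbit n
    x₋ₑ-is-orbit k k<n u =
      u * d (e₋ k) , nw-conj-XS (e₋ k) (e₊ k) (e₋ (suc k)) (e₊ (suc k)) u (σw-fin minus k k<1+n) (σw-fin plus k k<1+n) (flipV-vec minus (fin k))
      where k<1+n = ℕₚ.<-trans k<n (ℕₚ.n<1+n n)

    s-is-orbit : Orbit (x (sRoot n) ◂ x₋ₑ₋ₑ-orbit) (suc n)
    s-is-orbit zero _ u =
      u * d eₗ₊ * d e₀₋ , ≡.subst (λ z → nw · x (sRoot n) u ≋ XL (vec minus z) (e₊ 1) (e₋ 1) (vec plus z) (u * d eₗ₊ * d e₀₋) · nw) (≡.sym fin-0) (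
      nw-conj-XL eₗ₊ e₀₊ e₀₋ eₗ₋ e₀₋ (e₊ 1) (e₋ 1) e₀₊ u (σw-eₗ plus) (σw-e₀ plus) (σw-e₀ minus) (σw-eₗ minus)
                 (flipV-vec plus _) (flipV-vec minus Fin.zero))
    s-is-orbit (suc k) (s≤s k<n) u =
      u * d (e₋ k) * d (e₋ (suc k)) ,
      nw-conj-XL (e₋ k) (e₊ (suc k)) (e₋ (suc k)) (e₊ k) (e₋ (suc k)) (e₊ (suc (suc k))) (e₋ (suc (suc k))) (e₊ (suc k)) u
                 (σw-fin minus k k<1+n) (σw-fin plus (suc k) (s≤s k<n)) (σw-fin minus (suc k) (s≤s k<n)) (σw-fin plus k k<1+n)
                 (flipV-vec minus _) (flipV-vec minus _)
      where k<1+n = ℕₚ.<-trans k<n (ℕₚ.n<1+n n)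

    t-is-orbit : Orbit (x (tRoot n) ◂ x₋ₑ₊ₑ-orbit) (suc n)
    t-is-orbit zero _ u =
      u * d eₗ₊ * d e₀₊ , ≡.subst (λ z → nw · x (tRoot n) u ≋ XL (vec minus z) (e₋ 1) (e₊ 1) (vec plus z) (u * d eₗ₊ * d e₀₊) · nw) (≡.sym fin-0) (
      nw-conj-XL eₗ₊ e₀₋ e₀₊ eₗ₋ e₀₋ (e₋ 1) (e₊ 1) e₀₊ u (σw-eₗ plus) (σw-e₀ minus) (σw-e₀ plus) (σw-eₗ minus)
                 (flipV-vec plus _) (flipV-vec plus Fin.zero))
    t-is-orbit (suc k) (s≤s k<n) u =
      u * d (e₋ k) * d (e₊ (suc k)) ,
      nw-conj-XL (e₋ k) (e₋ (suc k)) (e₊ (suc k)) (e₊ k) (e₋ (suc k)) (e₋ (suc (suc k))) (e₊ (suc (suc k))) (e₊ (suc k)) u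
                 (σw-fin minus k k<1+n) (σw-fin minus (suc k) (s≤s k<n)) (σw-fin plus (suc k) (s≤s k<n)) (σw-fin plus k k<1+n)
                 (flipV-vec minus _) (flipV-vec plus _)
      where k<1+n = ℕₚ.<-trans k<n (ℕₚ.n<1+n n)

    -t-is-orbit : Orbit (x (negR (tRoot n)) ◂ x₊ₑ₋ₑ-orbit) (suc n)
    -t-is-orbit zero _ u =
      u * d eₗ₋ * d e₀₋ , ≡.subst (λ z → nw · x (negR (tRoot n)) u ≋ XL (vec plus z) (e₊ 1) (e₋ 1) (vec minus z) (u * d eₗ₋ * d e₀₋) · nw) (≡.sym fin-0) (
      nw-conj-XL eₗ₋ e₀₊ e₀₋ eₗ₊ e₀₊ (e₊ 1) (e₋ 1) e₀₋ u (σw-eₗ minus) (σw-e₀ plus) (σw-e₀ minus) (σw-eₗ plus)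
                 (flipV-vec minus _) (flipV-vec minus Fin.zero))
    -t-is-orbit (suc k) (s≤s k<n) u =
      u * d (e₊ k) * d (e₋ (suc k)) ,
      nw-conj-XL (e₊ k) (e₊ (suc k)) (e₋ (suc k)) (e₋ k) (e₊ (suc k)) (e₊ (suc (suc k))) (e₋ (suc (suc k))) (e₋ (suc k)) u
                 (σw-fin plus k k<1+n) (σw-fin plus (suc k) (s≤s k<n)) (σw-fin minus (suc k) (s≤s k<n)) (σw-fin minus k k<1+n)
                 (flipV-vec plus _) (flipV-vec minus _)
      where k<1+n = ℕₚ.<-trans k<n (ℕₚ.n<1+n n)

    record ConjugatesIntoKb (i : ℕ) (A : Mat) : Set where
      constructor conjugates
      field
        {image}  : Mat
        image∈Kb : InKb image
        commutes : (nw ^ i) · A ≋ image · (nw ^ i)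

    ConjugatesIntoKb-· : ∀ {i A A′} → ConjugatesIntoKb i A → ConjugatesIntoKb i A′ → ConjugatesIntoKb i (A · A′)
    ConjugatesIntoKb-· {i} {A} {A′} (conjugates {B} B∈Kb nwA≋Bnw) (conjugates {B′} B′∈Kb nwA′≋B′nw) =
      conjugates (Gen-· B∈Kb B′∈Kb) (begin
        (nw ^ i) · (A · A′)   ≈⟨ ≋-sym (·-assoc (nw ^ i) A A′) ⟩
        ((nw ^ i) · A) · A′   ≈⟨ ·-congʳ {B = A′} nwA≋Bnw ⟩
        (B · (nw ^ i)) · A′   ≈⟨ ·-assoc B (nw ^ i) A′ ⟩
        B · ((nw ^ i) · A′)   ≈⟨ ·-congˡ {B} nwA′≋B′nw ⟩
        B · (B′ · (nw ^ i))   ≈⟨ ≋-sym (·-assoc B B′ (nw ^ i)) ⟩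
        (B · B′) · (nw ^ i)   ∎)
      where open ≋-Reasoning

    conj-x₋ᵣ₁ : ∀ i → i ≤ n → ConjugatesIntoKb i (x (negR (simpleRoot Fin.zero)) 1#)
    conj-x₋ᵣ₁ i i≤n =
      conjugates (InKb-x₋ₑ i (fin i) (toℕ-fin i (ℕₚ.<-trans (s≤s i≤n) (ℕₚ.n<1+n (suc n)))) (s≤s i≤n) u′)
                 (≡.subst (λ z → (nw ^ i) · XS (vec minus z) (vec plus z) 1# ≋ x₋ₑ-orbit i u′ · (nw ^ i)) fin-0 conj)
      where
      u′ : Carrier
      u′ = proj₁ (orbit-conj x₋ₑ-orbit n x₋ₑ-is-orbit i i≤n 1#)
      conj : (nw ^ i) · x₋ₑ-orbit 0 1# ≋ x₋ₑ-orbit i u′ · (nw ^ i)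
      conj = proj₂ (orbit-conj x₋ₑ-orbit n x₋ₑ-is-orbit i i≤n 1#)

    conj-xₛ : ∀ i → i < n → ConjugatesIntoKb (suc i) (x (sRoot n) 1#)
    conj-xₛ i i<n =
      conjugates (InKb-x₋ₑ₋ₑ i (fin i) (fin (suc i)) (toℕ-fin i (ℕₚ.<-trans (ℕₚ.n<1+n i) 1+i<l)) (toℕ-fin (suc i) 1+i<l) (s≤s i<n) _)
                 (proj₂ (orbit-conj (x (sRoot n) ◂ x₋ₑ₋ₑ-orbit) (suc n) s-is-orbit (suc i) (s≤s (ℕₚ.<⇒≤ i<n)) 1#))
      where 1+i<l = ℕₚ.<-trans (s≤s i<n) (ℕₚ.n<1+n (suc n))

    conj-xₜ : ∀ i → i < n → ∀ u → ConjugatesIntoKb (suc i) (x (tRoot n) u)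
    conj-xₜ i i<n u =
      conjugates (InKb-x₋ₑ₊ₑ (fin i) (fin (suc i)) (toℕ-fin-suc i (ℕₚ.<-trans i<n (ℕₚ.n<1+n n))) (toℕ-fin< (suc i) (s≤s i<n)) _)
                 (proj₂ (orbit-conj (x (tRoot n) ◂ x₋ₑ₊ₑ-orbit) (suc n) t-is-orbit (suc i) (s≤s (ℕₚ.<⇒≤ i<n)) u))

    conj-x₋ₜ : ∀ i → i < n → ∀ u → ConjugatesIntoKb (suc i) (x (negR (tRoot n)) u)
    conj-x₋ₜ i i<n u =
      conjugates (InKb-x₊ₑ₋ₑ (fin i) (fin (suc i)) (toℕ-fin-suc i (ℕₚ.<-trans i<n (ℕₚ.n<1+n n))) (toℕ-fin< (suc i) (s≤s i<n)) _)
                 (proj₂ (orbit-conj (x (negR (tRoot n)) ◂ x₊ₑ₋ₑ-orbit) (suc n) -t-is-orbit (suc i) (s≤s (ℕₚ.<⇒≤ i<n)) u))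

    conj-nₜ : ∀ i → i < n → ∀ u → ConjugatesIntoKb (suc i) (nR (tRoot n) u)
    conj-nₜ i i<n u = ConjugatesIntoKb-· (conj-xₜ i i<n u) (ConjugatesIntoKb-· (conj-x₋ₜ i i<n (- (u ⁻¹))) (conj-xₜ i i<n u))

    conj-hₜ : ∀ i → i < n → ∀ u → ConjugatesIntoKb (suc i) (hₜ u)
    conj-hₜ i i<n u = ConjugatesIntoKb-· (conj-nₜ i i<n u) (conj-nₜ i i<n (- 1#))

    conj-hₜ⁻¹ : ∀ i → i < n → ∀ u → ConjugatesIntoKb (suc i) (hₜ⁻¹ u)
    conj-hₜ⁻¹ i i<n u = ConjugatesIntoKb-· (conj-nₜ i i<n (- 1#)) (conj-nₜ i i<n u)

AllPairs-lookup : ∀ {A : Set} {_~_ : A → A → Set} {xs} → AllPairs _~_ xs →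
                  ∀ {i j} → i Fin.< j → lookup xs i ~ lookup xs j
AllPairs-lookup (x≁xs ∷ _)    {Fin.zero}  {Fin.suc j} _         = All.lookup x≁xs (∈-lookup j)
AllPairs-lookup (_ ∷ xs-pairs) {Fin.suc i} {Fin.suc j} (s≤s i<j) = AllPairs-lookup xs-pairs i<j

injective-pairs⇒≤ : ∀ {b m c a} (f : Fin b → Fin m → Fin c × Fin a) →
                    (∀ p j p′ j′ → f p j ≡ f p′ j′ → p ≡ p′ × j ≡ j′) → b ℕ.* m ≤ c ℕ.* a
injective-pairs⇒≤ {b} {m} f f-injective = Finₚ.injective⇒≤ {f = g} g-injective
  where
  g : Fin (b ℕ.* m) → Fin _
  g z = let (p , j) = Fin.remQuot m z ; (t , i) = f p j in Fin.combine t i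
  g-injective : ∀ {z z′} → g z ≡ g z′ → z ≡ z′
  g-injective {z} {z′} gz≡gz′ =
    let (p , j) = Fin.remQuot {b} m z ; (p′ , j′) = Fin.remQuot {b} m z′
        (t , i) = f p j ; (t′ , i′) = f p′ j′
        (t≡t′ , i≡i′) = Finₚ.combine-injective t i t′ i′ gz≡gz′
        (p≡p′ , j≡j′) = f-injective p j p′ j′ (≡.cong₂ _,_ t≡t′ i≡i′)
    in ≡.trans (≡.sym (Finₚ.combine-remQuot {b} m z))
               (≡.trans (≡.cong₂ Fin.combine p≡p′ j≡j′) (Finₚ.combine-remQuot {b} m z′))


module RowInvariance (F : FiniteField2) (n : ℕ) where
  open Conjugation F n public

  RowRFixed : Mat → Set
  RowRFixed A = ∀ j → A R j ≈ δ R j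

  RowRFixed-·ˡ : ∀ {A} → RowRFixed A → ∀ B j → (A · B) R j ≈ B R j
  RowRFixed-·ˡ {A} A-fixed B j =
    trans (Σ′-cong (λ k → A R k * B k j) (λ k → δ R k * B k j) (λ k → *-congʳ (A-fixed k))) (Σ′-δˡ R (λ k → B k j))

  RowRFixed-· : ∀ {A B} → RowRFixed A → RowRFixed B → RowRFixed (A · B)
  RowRFixed-· {A} {B} A-fixed B-fixed j = trans (RowRFixed-·ˡ {A} A-fixed B j) (B-fixed j)

  XS-RowRFixed : ∀ p q u → R ≢ v0 → R ≢ p → RowRFixed (XS p q u)
  XS-RowRFixed p q u R≢v0 R≢p j =
    trans (+-cong (+-congˡ (*-congˡ (*-congʳ (δ-≢ R≢v0)))) (*-congˡ (*-congʳ (δ-≢ R≢p))))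
          (solve 3 (λ a b w → (a :+ w :* (con 0 :* b)) :+ (w :* w) :* (con 0 :* b) := a) refl (δ R j) (δ j q) u)

  XL-RowRFixed : ∀ p q′ q p′ u → R ≢ p → R ≢ q → RowRFixed (XL p q′ q p′ u)
  XL-RowRFixed p q′ q p′ u R≢p R≢q j =
    trans (+-congˡ (*-congˡ (+-cong (*-congʳ (δ-≢ R≢p)) (*-congʳ (δ-≢ R≢q)))))
          (solve 4 (λ a b c w → a :+ w :* (con 0 :* b :+ con 0 :* c) := a) refl (δ R j) (δ j q′) (δ j p′) u)

  R≢plus : ∀ c → toℕ c < suc n → R ≢ vec plus c
  R≢plus c c<1+n R≡c = ℕₚ.<-irrefl (≡.trans (≡.sym (≡.cong toℕ (vec-injectiveⁱ {plus} {plus} R≡c))) (Finₚ.toℕ-fromℕ (suc n))) c<1+n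

  R≢minus : ∀ c → R ≢ vec minus c
  R≢minus c R≡c with () ← vec-injectiveˢ {plus} {minus} R≡c

  KbGen-RowRFixed : ∀ {A} → KbGen A → RowRFixed A
  KbGen-RowRFixed (Fin.zero    , _     , plus  , u , ≡.refl) = XS-RowRFixed _ _ u (λ ()) (R≢plus Fin.zero (s≤s z≤n))
  KbGen-RowRFixed (Fin.zero    , _     , minus , u , ≡.refl) = XS-RowRFixed _ _ u (λ ()) (R≢minus Fin.zero)
  KbGen-RowRFixed (Fin.suc k   , k<1+n , plus  , u , ≡.refl) = XL-RowRFixed _ _ _ _ u (R≢plus (Fin.suc k) k<1+n) (R≢minus (inject₁ k))
  KbGen-RowRFixed (Fin.suc k   , k<1+n , minus , u , ≡.refl) =
    XL-RowRFixed _ _ _ _ u (R≢minus (Fin.suc k))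
                 (R≢plus (inject₁ k) (≡.subst (_< suc n) (≡.sym (Finₚ.toℕ-inject₁ k)) (ℕₚ.<-trans (ℕₚ.n<1+n _) k<1+n)))

  InKb-RowRFixed : ∀ {A} → InKb A → RowRFixed A
  InKb-RowRFixed {A} (gs , Kbgs , ∏gs≈A) j = trans (sym (∏gs≈A R j)) (prod-RowRFixed gs Kbgs j)
    where
    prod-RowRFixed : ∀ gs → All KbGen gs → RowRFixed (prod gs)
    prod-RowRFixed []       []            j = refl
    prod-RowRFixed (g ∷ gs) (Kbg ∷ Kbgs) = RowRFixed-· {g} {prod gs} (KbGen-RowRFixed Kbg) (prod-RowRFixed gs Kbgs)

module BoundaryCount (F : FiniteField2) (n : ℕ) where
  open RowInvariance F n public

  module _ (h : Mat) (h∈H : InH h) (λ′ : Carrier) where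
    open NwConjugation h h∈H public
    open ≋-Reasoning

    S ∂S : Mat → Set
    S  = Sb nw
    ∂S = Boundary (Conn nw λ′) S

    nw^⁻¹ : ℕ → Mat
    nw^⁻¹ zero    = I
    nw^⁻¹ (suc j) = nw^⁻¹ j · nw⁻¹

    nw^·nw^⁻¹≋I : ∀ j → (nw ^ j) · nw^⁻¹ j ≋ I
    nw^·nw^⁻¹≋I zero    = ·-identityˡ I
    nw^·nw^⁻¹≋I (suc j) = begin
      (nw · (nw ^ j)) · (nw^⁻¹ j · nw⁻¹) ≈⟨ ·-assoc nw (nw ^ j) (nw^⁻¹ j · nw⁻¹) ⟩
      nw · ((nw ^ j) · (nw^⁻¹ j · nw⁻¹)) ≈⟨ ·-congˡ {nw} (≋-sym (·-assoc (nw ^ j) (nw^⁻¹ j) nw⁻¹)) ⟩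
      nw · (((nw ^ j) · nw^⁻¹ j) · nw⁻¹) ≈⟨ ·-congˡ {nw} (≋-trans (·-congʳ {B = nw⁻¹} (nw^·nw^⁻¹≋I j)) (·-identityˡ nw⁻¹)) ⟩
      nw · nw⁻¹                        ≈⟨ nw·nw⁻¹≋I ⟩
      I                                ∎

    ·nw^-cancelʳ : ∀ k k′ j → k · (nw ^ j) ≋ k′ · (nw ^ j) → k ≋ k′
    ·nw^-cancelʳ k k′ j knw^j≋k′nw^j = begin
      k                              ≈⟨ ≋-sym (·-identityʳ k) ⟩
      k · I                          ≈⟨ ·-congˡ {k} (≋-sym (nw^·nw^⁻¹≋I j)) ⟩
      k · ((nw ^ j) · nw^⁻¹ j)         ≈⟨ ≋-sym (·-assoc k (nw ^ j) (nw^⁻¹ j)) ⟩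
      (k · (nw ^ j)) · nw^⁻¹ j         ≈⟨ ·-congʳ {B = nw^⁻¹ j} knw^j≋k′nw^j ⟩
      (k′ · (nw ^ j)) · nw^⁻¹ j        ≈⟨ ·-assoc k′ (nw ^ j) (nw^⁻¹ j) ⟩
      k′ · ((nw ^ j) · nw^⁻¹ j)        ≈⟨ ·-congˡ {k′} (nw^·nw^⁻¹≋I j) ⟩
      k′ · I                         ≈⟨ ·-identityʳ k′ ⟩
      k′                             ∎

    Kb·nw^-differ : ∀ k k′ j j′ → InKb k → InKb k′ → j < j′ → j′ ≤ n → ¬ k · (nw ^ j) ≋ k′ · (nw ^ j′)
    Kb·nw^-differ k k′ j j′ k∈Kb k′∈Kb j<j′ j′≤n (mk knw^j≈k′nw^j′) =
      let (c , nw^j≈0 , nw^j′≉0) = nw^-R-rows-differ j j′ j<j′ j′≤n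
      in nw^j′≉0 (trans (sym (RowRFixed-·ˡ {k′} (InKb-RowRFixed {k′} k′∈Kb) (nw ^ j′) c))
                        (trans (sym (knw^j≈k′nw^j′ R c)) (trans (RowRFixed-·ˡ {k} (InKb-RowRFixed {k} k∈Kb) (nw ^ j) c) nw^j≈0)))

    Kb·nw^-index-unique : ∀ k k′ j j′ → InKb k → InKb k′ → j ≤ n → j′ ≤ n → k · (nw ^ j) ≋ k′ · (nw ^ j′) → j ≡ j′
    Kb·nw^-index-unique k k′ j j′ k∈Kb k′∈Kb j≤n j′≤n knw^j≋k′nw^j′ = by-trichotomy (ℕₚ.<-cmp j j′)
      where
      by-trichotomy : Tri (j < j′) (j ≡ j′) (j′ < j) → j ≡ j′
      by-trichotomy (tri< j<j′ _ _) = ⊥-elim (Kb·nw^-differ k k′ j j′ k∈Kb k′∈Kb j<j′ j′≤n knw^j≋k′nw^j′)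
      by-trichotomy (tri≈ _ j≡j′ _) = j≡j′
      by-trichotomy (tri> _ _ j′<j) = ⊥-elim (Kb·nw^-differ k′ k j′ j k′∈Kb k∈Kb j′<j j≤n (≋-sym knw^j≋k′nw^j′))

    ∈S : ∀ {g} i → i < suc n → ∀ k → InKb k → g ≋ k · (nw ^ i) → S g
    ∈S i i<1+n k k∈Kb g≋knw^i = i , i<1+n , k , k∈Kb , get g≋knw^i

    ∈S-conj : ∀ {g} i → i < suc n → ∀ k → InKb k → ∀ A → ConjugatesIntoKb i A → g ≋ (k · (nw ^ i)) · A → S g
    ∈S-conj {g} i i<1+n k k∈Kb A (conjugates {B} B∈Kb nw^iA≋Bnw^i) g≋knw^iA = ∈S i i<1+n (k · B) (Gen-· k∈Kb B∈Kb) (begin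
      g                   ≈⟨ g≋knw^iA ⟩
      (k · (nw ^ i)) · A  ≈⟨ ·-assoc k (nw ^ i) A ⟩
      k · ((nw ^ i) · A)  ≈⟨ ·-congˡ {k} nw^iA≋Bnw^i ⟩
      k · (B · (nw ^ i))  ≈⟨ ≋-sym (·-assoc k B (nw ^ i)) ⟩
      (k · B) · (nw ^ i)  ∎)

    ·nw^0· : ∀ k A → (k · (nw ^ 0)) · A ≋ k · A
    ·nw^0· k A = ·-congʳ {B = A} (·-identityʳ k)

    ·nw^1+i·nw⁻¹ : ∀ k i → (k · (nw ^ suc i)) · nw⁻¹ ≋ k · (nw ^ i)
    ·nw^1+i·nw⁻¹ k i = begin
      (k · (nw ^ suc i)) · nw⁻¹     ≈⟨ ·-assoc k (nw ^ suc i) nw⁻¹ ⟩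
      k · ((nw ^ suc i) · nw⁻¹)     ≈⟨ ·-congˡ {k} (·-congʳ {B = nw⁻¹} (^-sucʳ nw i)) ⟩
      k · (((nw ^ i) · nw) · nw⁻¹)  ≈⟨ ·-congˡ {k} (·-assoc (nw ^ i) nw nw⁻¹) ⟩
      k · ((nw ^ i) · (nw · nw⁻¹))  ≈⟨ ·-congˡ {k} (≋-trans (·-congˡ {nw ^ i} nw·nw⁻¹≋I) (·-identityʳ (nw ^ i))) ⟩
      k · (nw ^ i)                  ∎

    ·nw^i·nw : ∀ k i → (k · (nw ^ i)) · nw ≋ k · (nw ^ suc i)
    ·nw^i·nw k i = ≋-trans (·-assoc k (nw ^ i) nw) (·-congˡ {k} (≋-sym (^-sucʳ nw i)))

    xₛ x₋ᵣ₁ : Mat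
    xₛ   = x (sRoot n) 1#
    x₋ᵣ₁ = x (negR (simpleRoot Fin.zero)) 1#

    boundaryCoset : Fin 5 → Mat
    boundaryCoset Fin.zero                                         = xₛ
    boundaryCoset (Fin.suc Fin.zero)                               = nw⁻¹
    boundaryCoset (Fin.suc (Fin.suc Fin.zero))                     = nw ^ suc n
    boundaryCoset (Fin.suc (Fin.suc (Fin.suc Fin.zero)))           = hₜ⁻¹ λ′
    boundaryCoset (Fin.suc (Fin.suc (Fin.suc (Fin.suc Fin.zero)))) = hₜ λ′

    record InBoundaryCoset (g : Mat) : Set where
      constructor in-coset
      field
        coset     : Fin 5
        {k}       : Mat
        k∈Kb      : InKb k
        g≋k·coset : g ≋ k · boundaryCoset coset

    -- From g · c = k n_w^i: unless (c, i) is one of five exceptional pairs, n_w^i c⁻¹ n_w^{-i} ∈ K_b puts g in S_b.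
    ∂S⊆cosets : ∀ g → ∂S g → InBoundaryCoset g
    ∂S⊆cosets g (_ , g∉S , c , c∈Conn , i , i<1+n , k , k∈Kb , gc≈knw^i) = by-connection i i<1+n (mk gc≈knw^i) c∈Conn
      where
      in-S : ∀ i C⁻¹ → i < suc n → g · c ≋ k · (nw ^ i) → c · C⁻¹ ≋ I → ConjugatesIntoKb i C⁻¹ → S g
      in-S i C⁻¹ i<1+n gc≋knw^i cC⁻¹≋I conj = ∈S-conj i i<1+n k k∈Kb C⁻¹ conj (cancelʳ g c C⁻¹ (k · (nw ^ i)) gc≋knw^i cC⁻¹≋I)
      at-power-0 : ∀ τ → g · c ≋ k · (nw ^ 0) → c · boundaryCoset τ ≋ I → InBoundaryCoset g
      at-power-0 τ gc≋k cC⁻¹≋I =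
        in-coset τ k∈Kb (≋-trans (cancelʳ g c (boundaryCoset τ) (k · (nw ^ 0)) gc≋k cC⁻¹≋I) (·nw^0· k (boundaryCoset τ)))
      by-connection : ∀ i → i < suc n → g · c ≋ k · (nw ^ i) → Conn nw λ′ c → InBoundaryCoset g
      by-connection zero _ gc≋k (inj₁ c≈xₛ) =
        at-power-0 Fin.zero gc≋k (right-inverse-cong xₛ xₛ c≈xₛ (x-involutive (sRoot n) 1#))
      by-connection (suc i) (s≤s i<n) gc≋knw^i (inj₁ c≈xₛ) =
        ⊥-elim (g∉S (in-S (suc i) xₛ (s≤s i<n) gc≋knw^i (right-inverse-cong xₛ xₛ c≈xₛ (x-involutive (sRoot n) 1#)) (conj-xₛ i i<n)))
      by-connection i (s≤s i≤n) gc≋knw^i (inj₂ (inj₁ c≈x₋ᵣ₁)) =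
        ⊥-elim (g∉S (in-S i x₋ᵣ₁ (s≤s i≤n) gc≋knw^i (right-inverse-cong x₋ᵣ₁ x₋ᵣ₁ c≈x₋ᵣ₁ (x-involutive (negR (simpleRoot Fin.zero)) 1#))
                          (conj-x₋ᵣ₁ i i≤n)))
      by-connection zero _ gc≋k (inj₂ (inj₂ (inj₁ c≈nw))) =
        at-power-0 (Fin.suc Fin.zero) gc≋k (right-inverse-cong nw nw⁻¹ c≈nw nw·nw⁻¹≋I)
      by-connection (suc i) 1+i<1+n gc≋knw^1+i (inj₂ (inj₂ (inj₁ c≈nw))) =
        ⊥-elim (g∉S (∈S i (ℕₚ.<-trans (ℕₚ.n<1+n i) 1+i<1+n) k k∈Kb
                        (≋-trans (cancelʳ g c nw⁻¹ (k · (nw ^ suc i)) gc≋knw^1+i (right-inverse-cong nw nw⁻¹ c≈nw nw·nw⁻¹≋I))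
                                 (·nw^1+i·nw⁻¹ k i))))
      by-connection i (s≤s i≤n) gc≋knw^i (inj₂ (inj₂ (inj₂ (inj₁ nwc≈I)))) = by-power (i ℕ.<? n)
        where
        c·nw≋I : c · nw ≋ I
        c·nw≋I = ≋-trans (·-congʳ {B = nw} (inverse-unique nw nw⁻¹ c nw⁻¹·nw≋I (mk {nw · c} {I} nwc≈I))) nw⁻¹·nw≋I
        g≋knw^1+i : g ≋ k · (nw ^ suc i)
        g≋knw^1+i = ≋-trans (cancelʳ g c nw (k · (nw ^ i)) gc≋knw^i c·nw≋I) (·nw^i·nw k i)
        by-power : Dec (i < n) → InBoundaryCoset g
        by-power (yes i<n) = ⊥-elim (g∉S (∈S (suc i) (s≤s i<n) k k∈Kb g≋knw^1+i))
        by-power (no i≮n)  = in-coset (Fin.suc (Fin.suc Fin.zero)) k∈Kb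
                                      (≡.subst (λ j → g ≋ k · (nw ^ suc j)) (ℕₚ.≤-antisym i≤n (ℕₚ.≮⇒≥ i≮n)) g≋knw^1+i)
      by-connection zero _ gc≋k (inj₂ (inj₂ (inj₂ (inj₂ (inj₁ c≈hₜ))))) =
        at-power-0 (Fin.suc (Fin.suc (Fin.suc Fin.zero))) gc≋k (right-inverse-cong (hₜ λ′) (hₜ⁻¹ λ′) c≈hₜ (hₜ·hₜ⁻¹≋I λ′))
      by-connection (suc i) (s≤s i<n) gc≋knw^i (inj₂ (inj₂ (inj₂ (inj₂ (inj₁ c≈hₜ))))) =
        ⊥-elim (g∉S (in-S (suc i) (hₜ⁻¹ λ′) (s≤s i<n) gc≋knw^i (right-inverse-cong (hₜ λ′) (hₜ⁻¹ λ′) c≈hₜ (hₜ·hₜ⁻¹≋I λ′))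
                          (conj-hₜ⁻¹ i i<n λ′)))
      by-connection i i<1+n gc≋knw^i (inj₂ (inj₂ (inj₂ (inj₂ (inj₂ hₜc≈I))))) = by-power i i<1+n gc≋knw^i
        where
        c·hₜ≋I : c · hₜ λ′ ≋ I
        c·hₜ≋I = ≋-trans (·-congʳ {B = hₜ λ′} (inverse-unique (hₜ λ′) (hₜ⁻¹ λ′) c (hₜ⁻¹·hₜ≋I λ′) (mk {hₜ λ′ · c} {I} hₜc≈I)))
                         (hₜ⁻¹·hₜ≋I λ′)
        by-power : ∀ i → i < suc n → g · c ≋ k · (nw ^ i) → InBoundaryCoset g
        by-power zero    _         gc≋k     = at-power-0 (Fin.suc (Fin.suc (Fin.suc (Fin.suc Fin.zero)))) gc≋k c·hₜ≋I
        by-power (suc i) (s≤s i<n) gc≋knw^i = ⊥-elim (g∉S (in-S (suc i) (hₜ λ′) (s≤s i<n) gc≋knw^i c·hₜ≋I (conj-hₜ i i<n λ′)))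

    -- (b, j) ↦ (coset of b, position of k_b · n_w^j in S_b) is injective on ∂S_b × {0, …, l-2}.
    boundary-count : (as bs : List Mat) → (∀ g → S g → Any (g ≈M_) as) → All ∂S bs → AllPairs (λ A B → ¬ A ≈M B) bs →
                     length bs ℕ.* suc n ≤ 5 ℕ.* length as
    boundary-count as bs as-covers-S bs⊆∂S bs-distinct = injective-pairs⇒≤ f f-injective
      where
      form : ∀ p → InBoundaryCoset (lookup bs p)
      form p = ∂S⊆cosets (lookup bs p) (All.lookup bs⊆∂S (∈-lookup p))
      kₚ : Fin (length bs) → Mat
      kₚ p = InBoundaryCoset.k (form p)
      kₚ∈Kb : ∀ p → InKb (kₚ p)
      kₚ∈Kb p = InBoundaryCoset.k∈Kb (form p)
      shifted∈as : ∀ p (j : Fin (suc n)) → Any ((kₚ p · (nw ^ toℕ j)) ≈M_) as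
      shifted∈as p j = as-covers-S (kₚ p · (nw ^ toℕ j)) (∈S (toℕ j) (Finₚ.toℕ<n j) (kₚ p) (kₚ∈Kb p) ≋-refl)
      f : Fin (length bs) → Fin (suc n) → Fin 5 × Fin (length as)
      f p j = InBoundaryCoset.coset (form p) , Any.index (shifted∈as p j)
      f-injective : ∀ p j p′ j′ → f p j ≡ f p′ j′ → p ≡ p′ × j ≡ j′
      f-injective p j p′ j′ fpj≡fp′j′ = p≡p′ , j≡j′
        where
        same-element : kₚ p · (nw ^ toℕ j) ≋ kₚ p′ · (nw ^ toℕ j′)
        same-element = ≋-trans (mk (Anyₚ.lookup-index (shifted∈as p j)))
                               (≋-trans (≋-reflexive (≡.cong (lookup as) (≡.cong proj₂ fpj≡fp′j′)))
                                        (≋-sym (mk (Anyₚ.lookup-index (shifted∈as p′ j′)))))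
        toℕj≡toℕj′ : toℕ j ≡ toℕ j′
        toℕj≡toℕj′ = Kb·nw^-index-unique (kₚ p) (kₚ p′) (toℕ j) (toℕ j′) (kₚ∈Kb p) (kₚ∈Kb p′)
                                          (ℕₚ.≤-pred (Finₚ.toℕ<n j)) (ℕₚ.≤-pred (Finₚ.toℕ<n j′)) same-element
        j≡j′ : j ≡ j′
        j≡j′ = Finₚ.toℕ-injective toℕj≡toℕj′
        kₚ≋kₚ′ : kₚ p ≋ kₚ p′
        kₚ≋kₚ′ = ·nw^-cancelʳ (kₚ p) (kₚ p′) (toℕ j)
                              (≡.subst (λ t → kₚ p · (nw ^ toℕ j) ≋ kₚ p′ · (nw ^ t)) (≡.sym toℕj≡toℕj′) same-element)
        same-coset : InBoundaryCoset.coset (form p) ≡ InBoundaryCoset.coset (form p′)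
        same-coset = ≡.cong proj₁ fpj≡fp′j′
        bₚ≋bₚ′ : lookup bs p ≋ lookup bs p′
        bₚ≋bₚ′ = ≋-trans (InBoundaryCoset.g≋k·coset (form p))
                         (≋-trans (·-cong kₚ≋kₚ′ (≋-reflexive (≡.cong boundaryCoset same-coset)))
                                  (≋-sym (InBoundaryCoset.g≋k·coset (form p′))))
        by-trichotomy : Tri (p Fin.< p′) (p ≡ p′) (p′ Fin.< p) → p ≡ p′
        by-trichotomy (tri< p<p′ _ _) = ⊥-elim (AllPairs-lookup bs-distinct p<p′ (get bₚ≋bₚ′))
        by-trichotomy (tri≈ _ p≡p′ _) = p≡p′
        by-trichotomy (tri> _ _ p′<p) = ⊥-elim (AllPairs-lookup bs-distinct p′<p (get (≋-sym bₚ≋bₚ′)))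
        p≡p′ : p ≡ p′
        p≡p′ = by-trichotomy (Finₚ.<-cmp p p′)

open FiniteField2 using (Carrier; _≈_; 0#)
open Setup using (Mat; InH; nProd; _·_; Sb; Boundary; Conn; HasSize; _^′_)

-- The bound holds for every λ.
lemma8 : (F : FiniteField2) (n : ℕ)
    (lam : Carrier F) → ¬ (_≈_ F lam (0# F)) →
    ((y : Carrier F) → ¬ (_≈_ F y (0# F)) →
      Σ ℕ (λ k → _≈_ F (_^′_ F n lam k) y)) →
    (h : Mat F n) → InH F n h →
    (a b : ℕ) →
    HasSize F n (Sb F n (_·_ F n (nProd F n) h)) a →
    HasSize F n (Boundary F n (Conn F n (_·_ F n (nProd F n) h) lam)
                              (Sb F n (_·_ F n (nProd F n) h))) b →
    suc n ℕ.* b ≤ 5 ℕ.* a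
lemma8 F n λ′ _ _ h h∈H a b (as , |as|≡a , _ , _ , as-covers-S) (bs , |bs|≡b , bs-distinct , bs⊆∂S , _) =
  ≡.subst₂ (λ b a → suc n ℕ.* b ≤ 5 ℕ.* a) |bs|≡b |as|≡a
    (≡.subst (_≤ 5 ℕ.* length as) (ℕₚ.*-comm (length bs) (suc n))
      (BoundaryCount.boundary-count F n h h∈H λ′ as bs as-covers-S bs⊆∂S bs-distinct))
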